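{- For every integer $n\ge4$, $\Theta_n(\lfloor n^2/4\rfloor+1)=\lfloor (n-1)^2/4\rfloor$.
   Context: All graphs are finite, simple and undirected. A clique cover of $G=(V,E)$ is a family of vertex sets, each inducing a clique, whose union is $V$ and such that every edge lies in some member. $\theta(G)$ is the minimum size of a clique cover of $G$. For $0\le m\le\binom n2$, $\Theta_n(m)$ is the maximum of $\theta(G)$ over all graphs $G$ with $n$ vertices and $m$ edges. -}

module Defs where

open import Data.Nat using (ℕ; _≤_; _<ᵇ_)
open import Data.Bool using (Bool; true; false; if_then_else_; _∧_)
open import Data.Fin using (Fin; toℕ)
open import Data.Fin.Subset using (Subset; _∈_)
open import Data.List using (List; length; map; allFin)
open import Data.Nat.ListAction using (sum)
open import Data.List.Relation.Unary.All using (All)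
import Data.List.Membership.Propositional as LM
open import Data.Product using (Σ; _×_; ∃)
open import Relation.Binary.PropositionalEquality using (_≡_; _≢_)

record Graph (n : ℕ) : Set where
  field
    adj    : Fin n → Fin n → Bool
    sym    : ∀ i j → adj i j ≡ adj j i
    irrefl : ∀ i → adj i i ≡ false
open Graph public

numEdges : ∀ {n} → Graph n → ℕ
numEdges {n} G =
  sum (map (λ i → sum (map (λ j → if (toℕ i <ᵇ toℕ j) ∧ adj G i j then 1 else 0)
                           (allFin n)))
           (allFin n))

IsClique : ∀ {n} → Graph n → Subset n → Set
IsClique G S = ∀ i j → i ∈ S → j ∈ S → i ≢ j → adj G i j ≡ true

IsCliqueCover : ∀ {n} → Graph n → List (Subset n) → Set
IsCliqueCover {n} G C =
  All (IsClique G) C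
  × (∀ (v : Fin n) → ∃ λ S → S LM.∈ C × v ∈ S)
  × (∀ (i j : Fin n) → adj G i j ≡ true → ∃ λ S → S LM.∈ C × i ∈ S × j ∈ S)

IsCliqueCoverNumber : ∀ {n} → Graph n → ℕ → Set
IsCliqueCoverNumber G k =
  (Σ _ λ C → IsCliqueCover G C × length C ≡ k)
  × (∀ C → IsCliqueCover G C → k ≤ length C)

IsMaxCliqueCoverNumber : ℕ → ℕ → ℕ → Set
IsMaxCliqueCoverNumber n m k =
  (Σ (Graph n) λ G → numEdges G ≡ m × IsCliqueCoverNumber G k)
  × (∀ (G : Graph n) → numEdges G ≡ m → ∀ k′ → IsCliqueCoverNumber G k′ → k′ ≤ k)

module Submission where

-- A vertex set S of size N is dense if it spans more than ⌊N²/4⌋ edges; dense sets have clique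
-- covers of size at most ⌊(N-1)²/4⌋. By induction on N, let v have minimum degree δ in S.
-- * If δ ≤ ⌊(N-1)/2⌋, then S - v is dense, and max(1, δ) cliques through v cover the edges at v.
-- * If δ ≥ ⌊N/2⌋ + 2, then v lies in a triangle vyw and S - v - y is dense; the N - 2 cliques
--   {z} ∪ (N(z) ∩ {v, y}) for z ∈ S - v - y restore a cover, and ⌊(N-1)²/4⌋ = ⌊(N-3)²/4⌋ + N - 2.
-- * If δ is ⌊N/2⌋ or ⌊N/2⌋ + 1, removing v is affordable only if the edges at v are covered by one or
--   two cliques fewer than δ, using a triangle or two disjoint edges in the neighbourhood of v. These
--   exist, at v or at a neighbour of v, unless S is too close to bipartite to be dense.
-- * If δ = N - 1, then S is a clique.
-- The bound is attained by K_{⌊n/2⌋,⌈n/2⌉} plus one edge xy inside the larger side: no clique contains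
-- two of the ⌊n/2⌋(⌈n/2⌉ - 1) edges between the smaller side and the larger side without x.

open import Data.Nat
  using (ℕ; zero; suc; _+_; _*_; _∸_; _⊔_; _≤_; _<_; z≤n; s≤s; _≤?_; _<?_; _<ᵇ_; ⌊_/2⌋)
  renaming (_≟_ to _≟ℕ_)
open import Data.Nat.Properties hiding (_≟_)
open import Data.Nat.DivMod using (_/_; _%_; m*n/n≡m; +-distrib-/; m*n%n≡0)
import Data.Nat.ListAction as List
open import Data.Nat.Tactic.RingSolver using (solve-∀)
open import Data.Bool using (Bool; true; false; if_then_else_; _∧_; _∨_; not; _xor_)
open import Data.Bool.Properties
  using ( ∧-comm; ∧-identityʳ; ∧-zeroʳ; ∧-conicalˡ; ∧-conicalʳ
        ; ∨-comm; ∨-identityʳ; ∨-conicalˡ; ∨-conicalʳ; xor-comm; xor-same)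
  renaming (_≟_ to _≟ᵇ_)
open import Data.Fin using (Fin; zero; suc; toℕ; _↑ˡ_; _↑ʳ_; splitAt; remQuot; combine)
open import Data.Fin.Properties
  using ( _≟_; any?; toℕ-injective; ↑ˡ-injective; ↑ʳ-injective; splitAt-↑ˡ; splitAt-↑ʳ
        ; combine-remQuot; injective⇒≤)
  renaming (suc-injective to Fin-suc-injective)
open import Data.Fin.Subset using (Subset) renaming (_∈_ to _∈ₛ_)
import Data.Vec as Vec
import Data.Vec.Properties as Vec
open import Data.List using (List; []; _∷_; [_]; _++_; length; map; allFin; tabulate; lookup)
open import Data.List.Properties using (length-++; length-map; map-tabulate)
open import Data.List.Membership.Propositional using (_∈_)
open import Data.List.Membership.Propositional.Properties
  using (∈-++⁺ˡ; ∈-++⁺ʳ; ∈-++⁻; ∈-map⁺; ∈-map⁻)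
open import Data.List.Relation.Unary.Any using (here; there; index)
open import Data.List.Relation.Unary.Any.Properties using (lookup-index)
import Data.List.Relation.Unary.All as All
open import Data.Product using (_×_; _,_; ∃; ∃₂; proj₁; proj₂; uncurry)
open import Data.Sum using (_⊎_; inj₁; inj₂; map₁)
open import Data.Empty using (⊥; ⊥-elim)
open import Function using (_∘_; case_of_)
open import Relation.Nullary using (¬_; Dec; yes; no; does)
open import Relation.Nullary.Decidable using (dec-true; dec-false; map′)
open import Relation.Nullary.Reflects using (ofʸ; ofⁿ)
open import Relation.Binary.PropositionalEquality hiding ([_])
open import Algebra.Properties.CommutativeSemigroup +-commutativeSemigroup using (x∙yz≈y∙xz)
open import Algebra.Properties.Semiring.Sum +-*-semiring
  using (sum; sum-syntax; sum-cong-≗; ∑-distrib-+; ∑-comm; *-distribˡ-sum; *-distribʳ-sum)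
open import Defs hiding (sym)

∧-intro : ∀ {a b} → a ≡ true → b ≡ true → a ∧ b ≡ true
∧-intro refl refl = refl

∧-elimˡ : ∀ {a b} → a ∧ b ≡ true → a ≡ true
∧-elimˡ {a} {b} = ∧-conicalˡ a b

∧-elimʳ : ∀ {a b} → a ∧ b ≡ true → b ≡ true
∧-elimʳ {a} {b} = ∧-conicalʳ a b

∧-swapʳ : ∀ a b c → (a ∧ b) ∧ c ≡ (a ∧ c) ∧ b
∧-swapʳ true b c = ∧-comm b c
∧-swapʳ false b c = refl

∨-introˡ : ∀ {a} b → a ≡ true → a ∨ b ≡ true
∨-introˡ b refl = refl

∨-introʳ : ∀ a {b} → b ≡ true → a ∨ b ≡ true
∨-introʳ true _ = refl
∨-introʳ false e = e

∨-false : ∀ {a b} → a ∨ b ≡ false → a ≡ false × b ≡ false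
∨-false {a} {b} e = ∨-conicalˡ a b e , ∨-conicalʳ a b e

∨-elim : ∀ {a b} → a ∨ b ≡ true → a ≡ true ⊎ b ≡ true
∨-elim {true} _ = inj₁ refl
∨-elim {false} e = inj₂ e

not-intro : ∀ {a} → a ≡ false → not a ≡ true
not-intro refl = refl

not-elim : ∀ {a} → not a ≡ true → a ≡ false
not-elim {false} _ = refl

contraposeᵇ : ∀ {a b} → (a ≡ true → b ≡ false) → b ≡ true → a ≡ false
contraposeᵇ {false} _ _ = refl
contraposeᵇ {true} a⇒¬b b = case trans (sym (a⇒¬b refl)) b of λ ()

𝟙 : Bool → ℕ
𝟙 true = 1
𝟙 false = 0

𝟙-∧ : ∀ a b → 𝟙 (a ∧ b) ≡ 𝟙 a * 𝟙 b
𝟙-∧ true b = sym (+-identityʳ (𝟙 b))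
𝟙-∧ false b = refl

𝟙-∨ : ∀ a b → 𝟙 (a ∨ b) ≤ 𝟙 a + 𝟙 b
𝟙-∨ true b = s≤s z≤n
𝟙-∨ false b = ≤-refl

𝟙-∨-disjoint : ∀ a b → (a ≡ true → b ≡ false) → 𝟙 (a ∨ b) ≡ 𝟙 a + 𝟙 b
𝟙-∨-disjoint true b a⇒¬b rewrite a⇒¬b refl = refl
𝟙-∨-disjoint false b _ = refl

𝟙-mono : ∀ {a b} → (a ≡ true → b ≡ true) → 𝟙 a ≤ 𝟙 b
𝟙-mono {false} _ = z≤n
𝟙-mono {true} a⇒b rewrite a⇒b refl = ≤-refl

𝟙-split : ∀ a b → 𝟙 a ≡ 𝟙 (a ∧ b) + 𝟙 (a ∧ not b)
𝟙-split true true = refl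
𝟙-split true false = refl
𝟙-split false b = refl

_==_ : ∀ {m} → Fin m → Fin m → Bool
i == j = does (i ≟ j)

==-refl : ∀ {m} (i : Fin m) → i == i ≡ true
==-refl i = dec-true (i ≟ i) refl

==⇒≡ : ∀ {m} {i j : Fin m} → i == j ≡ true → i ≡ j
==⇒≡ {i = i} {j} e with i ≟ j
... | yes i≡j = i≡j

≢⇒==false : ∀ {m} {i j : Fin m} → i ≢ j → i == j ≡ false
≢⇒==false {i = i} {j} = dec-false (i ≟ j)

==false⇒≢ : ∀ {m} {i j : Fin m} → i == j ≡ false → i ≢ j
==false⇒≢ {i = i} e refl with () ← trans (sym e) (==-refl i)

sum-mono-≤ : ∀ {m} {f g : Fin m → ℕ} → (∀ i → f i ≤ g i) → sum f ≤ sum g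
sum-mono-≤ {zero} _ = z≤n
sum-mono-≤ {suc m} f≤g = +-mono-≤ (f≤g zero) (sum-mono-≤ (f≤g ∘ suc))

sum-zero : ∀ {m} {f : Fin m → ℕ} → (∀ i → f i ≡ 0) → sum f ≡ 0
sum-zero {zero} _ = refl
sum-zero {suc m} f≡0 = cong₂ _+_ (f≡0 zero) (sum-zero (f≡0 ∘ suc))

sum-point : ∀ {m} (v : Fin m) (f : Fin m → ℕ) → ∑[ i < m ] (𝟙 (i == v) * f i) ≡ f v
sum-point {suc m} zero f = begin
  f zero + 0 + ∑[ i < m ] 0 ≡⟨ cong (f zero + 0 +_) (sum-zero {m} {λ _ → 0} (λ _ → refl)) ⟩
  f zero + 0 + 0            ≡⟨ +-identityʳ _ ⟩
  f zero + 0                ≡⟨ +-identityʳ _ ⟩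
  f zero                    ∎
  where open ≡-Reasoning
sum-point {suc m} (suc v) f = sum-point v (f ∘ suc)

sum-allFin : ∀ {m} (f : Fin m → ℕ) → List.sum (map f (allFin m)) ≡ sum f
sum-allFin {m} f = trans (cong List.sum (map-tabulate (λ i → i) f)) (go f)
  where
  go : ∀ {k} (g : Fin k → ℕ) → List.sum (tabulate g) ≡ sum g
  go {zero} g = refl
  go {suc k} g = cong (g zero +_) (go (g ∘ suc))

-- Vertex sets as characteristic functions

VSet : ℕ → Set
VSet m = Fin m → Bool

private variable m : ℕ

module _ {m : ℕ} where

  _∩_ _∪_ : VSet m → VSet m → VSet m
  (p ∩ q) i = p i ∧ q i
  (p ∪ q) i = p i ∨ q i

  ∁ : VSet m → VSet m
  ∁ p i = not (p i)

  ⁅_⁆ : Fin m → VSet m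
  ⁅ u ⁆ i = i == u

  _─_ : VSet m → Fin m → VSet m
  p ─ v = p ∩ ∁ ⁅ v ⁆

  ∅ full : VSet m
  ∅ _ = false
  full _ = true

  _⊆_ : VSet m → VSet m → Set
  p ⊆ q = ∀ i → p i ≡ true → q i ≡ true

  count : VSet m → ℕ
  count p = ∑[ i < m ] 𝟙 (p i)

  infixl 7 _∩_
  infixl 6 _∪_
  infixl 5 _─_
  infix 4 _⊆_

∈⁅⁆∪ : (a : Fin m) (q : VSet m) → (⁅ a ⁆ ∪ q) a ≡ true
∈⁅⁆∪ a q = ∨-introˡ (q a) (==-refl a)

∈∪⁅⁆ : (p : VSet m) (b : Fin m) → (p ∪ ⁅ b ⁆) b ≡ true
∈∪⁅⁆ p b = ∨-introʳ (p b) (==-refl b)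

∈⁅⁆-elim : {a t : Fin m} (Q : Fin m → Set) → Q a → ⁅ a ⁆ t ≡ true → Q t
∈⁅⁆-elim {a = a} {t} Q Qa t∈ = subst Q (sym (==⇒≡ {i = t} {a} t∈)) Qa

∈⁅⁆∪⁅⁆-elim : {a b t : Fin m} (Q : Fin m → Set) → Q a → Q b →
  (⁅ a ⁆ ∪ ⁅ b ⁆) t ≡ true → Q t
∈⁅⁆∪⁅⁆-elim Q Qa Qb t∈ with ∨-elim t∈
... | inj₁ t≡a = ∈⁅⁆-elim Q Qa t≡a
... | inj₂ t≡b = ∈⁅⁆-elim Q Qb t≡b

count-∪-disjoint : (p q : VSet m) → (∀ i → p i ≡ true → q i ≡ false) →
  count (p ∪ q) ≡ count p + count q
count-∪-disjoint p q disjoint =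
  trans (sum-cong-≗ (λ i → 𝟙-∨-disjoint (p i) (q i) (disjoint i))) (∑-distrib-+ (𝟙 ∘ p) (𝟙 ∘ q))

count-const∩ : ∀ {m} (b : Bool) (q : VSet m) → count (λ j → b ∧ q j) ≡ 𝟙 b * count q
count-const∩ true q = sym (+-identityʳ (count q))
count-const∩ {m} false q = sum-zero {m} (λ _ → refl)

count-cong : {p q : VSet m} → (∀ i → p i ≡ q i) → count p ≡ count q
count-cong p≗q = sum-cong-≗ (cong 𝟙 ∘ p≗q)

count-∩∁∅ : (p : VSet m) → count (p ∩ ∁ ∅) ≡ count p
count-∩∁∅ p = count-cong (λ i → ∧-identityʳ (p i))

count-mono : {p q : VSet m} → p ⊆ q → count p ≤ count q
count-mono p⊆q = sum-mono-≤ (λ i → 𝟙-mono (p⊆q i))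

count-split : (p q : VSet m) → count p ≡ count (p ∩ q) + count (p ∩ ∁ q)
count-split p q =
  trans (sum-cong-≗ (λ i → 𝟙-split (p i) (q i))) (∑-distrib-+ (𝟙 ∘ (p ∩ q)) (𝟙 ∘ (p ∩ ∁ q)))

count-∪ : (p q : VSet m) → count (p ∪ q) ≤ count p + count q
count-∪ p q =
  ≤-trans (sum-mono-≤ (λ i → 𝟙-∨ (p i) (q i))) (≤-reflexive (∑-distrib-+ (𝟙 ∘ p) (𝟙 ∘ q)))

count-∩⁅⁆ : (p : VSet m) (v : Fin m) → count (p ∩ ⁅ v ⁆) ≡ 𝟙 (p v)
count-∩⁅⁆ p v = trans (sum-cong-≗ (λ i → trans (𝟙-∧ (p i) (i == v)) (*-comm (𝟙 (p i)) _)))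
                      (sum-point v (𝟙 ∘ p))

count-⁅⁆ : (u : Fin m) → count ⁅ u ⁆ ≡ 1
count-⁅⁆ u = count-∩⁅⁆ (λ _ → true) u

count-⁅⁆∪⁅⁆ : (a b : Fin m) → count (⁅ a ⁆ ∪ ⁅ b ⁆) ≤ 2
count-⁅⁆∪⁅⁆ a b =
  ≤-trans (count-∪ ⁅ a ⁆ ⁅ b ⁆) (≤-reflexive (cong₂ _+_ (count-⁅⁆ a) (count-⁅⁆ b)))

count-─ : {p : VSet m} {v : Fin m} → p v ≡ true → count p ≡ suc (count (p ─ v))
count-─ {p = p} {v} pv =
  trans (count-split p ⁅ v ⁆) (cong (_+ count (p ─ v)) (trans (count-∩⁅⁆ p v) (cong 𝟙 pv)))

∈─ : (p : VSet m) {a b : Fin m} → p b ≡ true → b ≢ a → (p ─ a) b ≡ true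
∈─ _ pb b≢a = ∧-intro pb (not-intro (≢⇒==false b≢a))

∈⇒count≥1 : {p : VSet m} {i : Fin m} → p i ≡ true → 1 ≤ count p
∈⇒count≥1 {p = p} {i} pi = ≤-trans (≤-reflexive (sym (count-⁅⁆ i)))
  (count-mono {p = ⁅ i ⁆} {q = p} (λ j j≡i → subst (λ k → p k ≡ true) (sym (==⇒≡ j≡i)) pi))

count≥suc : {p : VSet m} {a : Fin m} {k : ℕ} → p a ≡ true → k ≤ count (p ─ a) → suc k ≤ count p
count≥suc {p = p} pa k≤ = ≤-trans (s≤s k≤) (≤-reflexive (sym (count-─ {p = p} pa)))

count≥1⇒∈ : ∀ {m} (p : VSet m) → 1 ≤ count p → ∃ λ i → p i ≡ true
count≥1⇒∈ {suc m} p h with p zero in e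
... | true = zero , e
... | false = let i , pi = count≥1⇒∈ (p ∘ suc) h in suc i , pi

⊆-count⇒⊇ : {p q : VSet m} → p ⊆ q → count q ≤ count p → q ⊆ p
⊆-count⇒⊇ {p = p} {q} p⊆q q≤p i qi with p i in e
... | true = refl
... | false = ⊥-elim (<⇒≱ p<q q≤p)
  where
  p⊆q─i : p ⊆ (q ─ i)
  p⊆q─i j pj = ∈─ q (p⊆q j pj) λ { refl → case trans (sym e) pj of λ () }
  p<q : count p < count q
  p<q = count≥suc {p = q} qi (count-mono {p = p} {q = q ─ i} p⊆q─i)

count-full : ∀ {m} → count {m} full ≡ m
count-full {zero} = refl
count-full {suc m} = cong suc (count-full {m})

argmin : ∀ {m} (p : VSet m) (f : Fin m → ℕ) → (∃ λ i → p i ≡ true) →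
  ∃ λ v → p v ≡ true × (∀ u → p u ≡ true → f v ≤ f u)
argmin {suc m} p f (i , pi) with any? (λ j → p (suc j) ≟ᵇ true)
... | no none = zero , p0 i pi , λ { zero _ → ≤-refl ; (suc j) pj → ⊥-elim (none (j , pj)) }
  where
  p0 : ∀ j → p j ≡ true → p zero ≡ true
  p0 zero pj = pj
  p0 (suc j) pj = ⊥-elim (none (j , pj))
... | yes ex with argmin (p ∘ suc) (f ∘ suc) ex | p zero in e
... | v , pv , min | false =
  suc v , pv , λ { zero p0 → case trans (sym e) p0 of λ () ; (suc j) pj → min j pj }
... | v , pv , min | true with f zero ≤? f (suc v)
...   | yes f0≤ = zero , e , λ { zero _ → ≤-refl ; (suc j) pj → ≤-trans f0≤ (min j pj) }
...   | no f0≰ = suc v , pv , λ { zero _ → <⇒≤ (≰⇒> f0≰) ; (suc j) pj → min j pj }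

collect : ∀ {m} {X : Set} → VSet m → (Fin m → X) → List X
collect {zero} p g = []
collect {suc m} p g with p zero
... | true = g zero ∷ collect (p ∘ suc) (g ∘ suc)
... | false = collect (p ∘ suc) (g ∘ suc)

length-collect : ∀ {m} {X : Set} (p : VSet m) (g : Fin m → X) → length (collect p g) ≡ count p
length-collect {zero} p g = refl
length-collect {suc m} p g with p zero
... | true = cong suc (length-collect (p ∘ suc) (g ∘ suc))
... | false = length-collect (p ∘ suc) (g ∘ suc)

∈-collect⁺ : ∀ {m} {X : Set} (p : VSet m) (g : Fin m → X) {i} → p i ≡ true → g i ∈ collect p g
∈-collect⁺ {suc m} p g {zero} pi with p zero
∈-collect⁺ {suc m} p g {zero} refl | true = here refl
∈-collect⁺ {suc m} p g {suc i} pi with p zero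
... | true = there (∈-collect⁺ (p ∘ suc) (g ∘ suc) pi)
... | false = ∈-collect⁺ (p ∘ suc) (g ∘ suc) pi

∈-collect⁻ : ∀ {m} {X : Set} (p : VSet m) (g : Fin m → X) {x} → x ∈ collect p g →
  ∃ λ i → p i ≡ true × x ≡ g i
∈-collect⁻ {suc m} p g x∈ with p zero in e
∈-collect⁻ {suc m} p g (here x≡) | true = zero , e , x≡
∈-collect⁻ {suc m} p g (there x∈) | true =
  let i , pi , x≡ = ∈-collect⁻ (p ∘ suc) (g ∘ suc) x∈ in suc i , pi , x≡
∈-collect⁻ {suc m} p g x∈ | false =
  let i , pi , x≡ = ∈-collect⁻ (p ∘ suc) (g ∘ suc) x∈ in suc i , pi , x≡

-- Quarter squares

⌊_²/4⌋ : ℕ → ℕ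
⌊ 0 ²/4⌋ = 0
⌊ 1 ²/4⌋ = 0
⌊ suc (suc n) ²/4⌋ = ⌊ n ²/4⌋ + suc n

⌊n²/4⌋-suc : ∀ n → ⌊ suc n ²/4⌋ ≡ ⌊ n ²/4⌋ + ⌊ suc n /2⌋
⌊n²/4⌋-suc 0 = refl
⌊n²/4⌋-suc 1 = refl
⌊n²/4⌋-suc (suc (suc n)) rewrite ⌊n²/4⌋-suc n = regroup ⌊ n ²/4⌋ ⌊ suc n /2⌋ n
  where
  regroup : ∀ a b n → a + b + suc (suc n) ≡ a + suc n + suc b
  regroup = solve-∀

⌊n²/4⌋+≤ : ∀ n {l} → l ≤ ⌊ suc n /2⌋ → ⌊ n ²/4⌋ + l ≤ ⌊ suc n ²/4⌋
⌊n²/4⌋+≤ n l≤ = ≤-trans (+-monoʳ-≤ ⌊ n ²/4⌋ l≤) (≤-reflexive (sym (⌊n²/4⌋-suc n)))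

⌊k+k²/4⌋ : ∀ k → ⌊ k + k ²/4⌋ ≡ k * k
⌊k+k²/4⌋ zero = refl
⌊k+k²/4⌋ (suc k) rewrite +-suc k k | ⌊k+k²/4⌋ k = regroup k
  where
  regroup : ∀ k → k * k + suc (k + k) ≡ suc (k + k * suc k)
  regroup = solve-∀

⌊1+k+k²/4⌋ : ∀ k → ⌊ suc (k + k) ²/4⌋ ≡ k * k + k
⌊1+k+k²/4⌋ zero = refl
⌊1+k+k²/4⌋ (suc k) rewrite +-suc k k | ⌊1+k+k²/4⌋ k = regroup k
  where
  regroup : ∀ k → k * k + k + suc (suc (k + k)) ≡ suc (k + k * suc k + suc k)
  regroup = solve-∀

data Parity (n : ℕ) : Set where
  even : n ≡ ⌊ n /2⌋ + ⌊ n /2⌋ → Parity n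
  odd  : n ≡ suc (⌊ n /2⌋ + ⌊ n /2⌋) → Parity n

parity : ∀ n → Parity n
parity 0 = even refl
parity 1 = odd refl
parity (suc (suc n)) with parity n
... | even e = even (cong suc (trans (cong suc e) (sym (+-suc ⌊ n /2⌋ ⌊ n /2⌋))))
... | odd e = odd (cong suc (trans (cong suc e) (cong suc (sym (+-suc ⌊ n /2⌋ ⌊ n /2⌋)))))

⌊1+n+n/2⌋≡n : ∀ n → ⌊ suc (n + n) /2⌋ ≡ n
⌊1+n+n/2⌋≡n zero = refl
⌊1+n+n/2⌋≡n (suc n) rewrite +-suc n n = cong suc (⌊1+n+n/2⌋≡n n)

n≤1+⌊n/2⌋+⌊n/2⌋ : ∀ n → n ≤ suc (⌊ n /2⌋ + ⌊ n /2⌋)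
n≤1+⌊n/2⌋+⌊n/2⌋ n with parity n
... | even e = ≤-trans (≤-reflexive e) (n≤1+n _)
... | odd e = ≤-reflexive e

⌊1+n/2⌋≤1+⌊n/2⌋ : ∀ n → ⌊ suc n /2⌋ ≤ suc ⌊ n /2⌋
⌊1+n/2⌋≤1+⌊n/2⌋ 0 = z≤n
⌊1+n/2⌋≤1+⌊n/2⌋ (suc n) = s≤s (⌊n/2⌋-mono (n≤1+n n))

n*n/4≡⌊n²/4⌋ : ∀ n → n * n / 4 ≡ ⌊ n ²/4⌋
n*n/4≡⌊n²/4⌋ n with parity n
... | even e = begin
  n * n / 4                 ≡⟨ cong (λ z → z * z / 4) e ⟩
  (k + k) * (k + k) / 4     ≡⟨ cong (_/ 4) (square k) ⟩
  k * k * 4 / 4             ≡⟨ m*n/n≡m (k * k) 4 ⟩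
  k * k                     ≡⟨ ⌊k+k²/4⌋ k ⟨
  ⌊ k + k ²/4⌋              ≡⟨ cong ⌊_²/4⌋ e ⟨
  ⌊ n ²/4⌋                  ∎
  where
  open ≡-Reasoning
  k : ℕ
  k = ⌊ n /2⌋
  square : ∀ k → (k + k) * (k + k) ≡ k * k * 4
  square = solve-∀
... | odd e = begin
  n * n / 4                           ≡⟨ cong (λ z → z * z / 4) e ⟩
  suc (k + k) * suc (k + k) / 4       ≡⟨ cong (_/ 4) (square k) ⟩
  (1 + (k * k + k) * 4) / 4           ≡⟨ +-distrib-/ 1 ((k * k + k) * 4) remainders ⟩
  0 + (k * k + k) * 4 / 4             ≡⟨ m*n/n≡m (k * k + k) 4 ⟩
  k * k + k                           ≡⟨ ⌊1+k+k²/4⌋ k ⟨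
  ⌊ suc (k + k) ²/4⌋                  ≡⟨ cong ⌊_²/4⌋ e ⟨
  ⌊ n ²/4⌋                            ∎
  where
  open ≡-Reasoning
  k : ℕ
  k = ⌊ n /2⌋
  square : ∀ k → suc (k + k) * suc (k + k) ≡ 1 + (k * k + k) * 4
  square = solve-∀
  remainders : 1 + (k * k + k) * 4 % 4 < 4
  remainders = s≤s (s≤s (≤-trans (≤-reflexive (m*n%n≡0 (k * k + k) 4)) z≤n))

≤-by : ∀ {a b} c → b ≡ a + c → a ≤ b
≤-by {a} c b≡ = ≤-trans (m≤m+n a c) (≤-reflexive (sym b≡))

⌊n/2⌋<m⇒n<m+m : ∀ N δ → ⌊ N /2⌋ < δ → N < δ + δ
⌊n/2⌋<m⇒n<m+m N δ h<δ = ≤-trans (s≤s (n≤1+⌊n/2⌋+⌊n/2⌋ N))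
  (≤-trans (≤-reflexive (sym (+-suc (suc ⌊ N /2⌋) ⌊ N /2⌋))) (+-mono-≤ h<δ h<δ))

1+a+a≤e+e⇒a<e : ∀ a e → suc (a + a) ≤ e + e → a < e
1+a+a≤e+e⇒a<e a e le with a <? e
... | yes a<e = a<e
... | no a≮e = ⊥-elim (<⇒≱ le (+-mono-≤ (≮⇒≥ a≮e) (≮⇒≥ a≮e)))

odd-budget : ∀ k D → 2 ≤ k → (∃ λ e → D ≡ e + e) → suc (k + k) * suc k ≤ D →
  2 * ⌊ k + k ²/4⌋ + 2 + 2 * suc k ≤ D
odd-budget 1 _ (s≤s ()) _ _
odd-budget (suc (suc j)) _ _ (e , refl) le rewrite ⌊k+k²/4⌋ (suc (suc j)) =
  ≤-trans (≤-reflexive (twice j)) (+-mono-≤ a<e a<e)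
  where
  a : ℕ
  a = suc (suc j) * suc (suc j) + suc (suc j) + 1
  expand : ∀ j → suc (suc (suc j) + suc (suc j)) * suc (suc (suc j)) ≡
    suc ((suc (suc j) * suc (suc j) + suc (suc j) + 1) + (suc (suc j) * suc (suc j) + suc (suc j) + 1)) + j
  expand = solve-∀
  twice : ∀ j → 2 * (suc (suc j) * suc (suc j)) + 2 + 2 * suc (suc (suc j)) ≡
    suc (suc (suc j) * suc (suc j) + suc (suc j) + 1) + suc (suc (suc j) * suc (suc j) + suc (suc j) + 1)
  twice = solve-∀
  a<e : suc a ≤ e
  a<e = 1+a+a≤e+e⇒a<e a e (≤-trans (≤-by j (expand j)) le)

even-budget : ∀ j D → 1 ≤ j → (suc j + suc j) * suc (suc j) ≤ D →
  2 * ⌊ suc (j + j) ²/4⌋ + 2 + 2 * suc (suc j) ≤ D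
even-budget (suc i) D _ le rewrite ⌊1+k+k²/4⌋ (suc i) = ≤-trans (≤-by (2 * i) (expand i)) le
  where
  expand : ∀ i → (suc (suc i) + suc (suc i)) * suc (suc (suc i)) ≡
    2 * (suc i * suc i + suc i) + 2 + 2 * suc (suc (suc i)) + 2 * i
  expand = solve-∀

half-too-sparse : ∀ k D → 2 * ⌊ k + k ²/4⌋ + 2 ≤ D → D ≤ (k + k) * k → ⊥
half-too-sparse k D dense sparse rewrite ⌊k+k²/4⌋ k = <⇒≱ (≤-trans (≤-by 1 (expand k)) dense) sparse
  where
  expand : ∀ k → 2 * (k * k) + 2 ≡ suc ((k + k) * k) + 1
  expand = solve-∀

fan-budget : ∀ M δ D d → 3 ≤ M → 3 + ⌊ M /2⌋ ≤ δ → (2 + M) * δ ≤ D + 2 * d + 2 * δ → d ≤ M →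
  2 * ⌊ M ²/4⌋ + 2 ≤ D
fan-budget M δ D d 3≤M δ≥ le d≤M = +-cancelʳ-≤ (2 * M) _ _ (begin
  2 * ⌊ M ²/4⌋ + 2 + 2 * M   ≤⟨ budget M (parity M) (1≤⌊M/2⌋ M 3≤M) ⟩
  M * (⌊ M /2⌋ + 3)          ≤⟨ *-monoʳ-≤ M (≤-trans (≤-reflexive (+-comm ⌊ M /2⌋ 3)) δ≥) ⟩
  M * δ                      ≤⟨ +-cancelʳ-≤ (2 * δ) _ _ (≤-trans (≤-reflexive (sym (distrib M δ))) le) ⟩
  D + 2 * d                  ≤⟨ +-monoʳ-≤ D (*-monoʳ-≤ 2 d≤M) ⟩
  D + 2 * M                  ∎)
  where
  open ≤-Reasoning
  1≤⌊M/2⌋ : ∀ M → 3 ≤ M → 1 ≤ ⌊ M /2⌋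
  1≤⌊M/2⌋ 1 (s≤s ())
  1≤⌊M/2⌋ (suc (suc M)) _ = s≤s z≤n
  distrib : ∀ M δ → (2 + M) * δ ≡ M * δ + 2 * δ
  distrib = solve-∀
  budget : ∀ M → Parity M → 1 ≤ ⌊ M /2⌋ → 2 * ⌊ M ²/4⌋ + 2 + 2 * M ≤ M * (⌊ M /2⌋ + 3)
  budget M (even e) _ with ⌊ M /2⌋ | e
  ... | suc k | refl rewrite ⌊k+k²/4⌋ (suc k) = ≤-by (2 * k) (expand k)
    where
    expand : ∀ k → (suc k + suc k) * (suc k + 3) ≡ 2 * (suc k * suc k) + 2 + 2 * (suc k + suc k) + 2 * k
    expand = solve-∀
  budget M (odd e) _ with ⌊ M /2⌋ | e
  ... | suc k | refl rewrite ⌊1+k+k²/4⌋ (suc k) = ≤-by k (expand k)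
    where
    expand : ∀ k → suc (suc k + suc k) * (suc k + 3) ≡
      2 * (suc k * suc k + suc k) + 2 + 2 * suc (suc k + suc k) + k
    expand = solve-∀

module _ {n : ℕ} (G : Graph n) where

  nbhd : Fin n → VSet n
  nbhd = adj G

  adj-sym : ∀ i j → adj G i j ≡ adj G j i
  adj-sym = Graph.sym G

  adj⇒≢ : ∀ {a b} → adj G a b ≡ true → a ≢ b
  adj⇒≢ {a} e refl with () ← trans (sym (irrefl G a)) e

  deg : VSet n → Fin n → ℕ
  deg S v = count (S ∩ nbhd v)

  degreeSum : VSet n → ℕ
  degreeSum S = ∑[ i < n ] (𝟙 (S i) * deg S i)

  deg-─ : (S : VSet n) {v : Fin n} → S v ≡ true → ∀ i → deg S i ≡ deg (S ─ v) i + 𝟙 (adj G i v)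
  deg-─ S {v} Sv i = begin
    count (S ∩ nbhd i)
      ≡⟨ count-split (S ∩ nbhd i) ⁅ v ⁆ ⟩
    count (S ∩ nbhd i ∩ ⁅ v ⁆) + count (S ∩ nbhd i ∩ ∁ ⁅ v ⁆)
      ≡⟨ +-comm (count (S ∩ nbhd i ∩ ⁅ v ⁆)) _ ⟩
    count (S ∩ nbhd i ∩ ∁ ⁅ v ⁆) + count (S ∩ nbhd i ∩ ⁅ v ⁆)
      ≡⟨ cong₂ _+_ (count-cong λ j → ∧-swapʳ (S j) (adj G i j) _) (count-∩⁅⁆ (S ∩ nbhd i) v) ⟩
    count ((S ─ v) ∩ nbhd i) + 𝟙 (S v ∧ adj G i v)
      ≡⟨ cong (λ b → deg (S ─ v) i + 𝟙 (b ∧ adj G i v)) Sv ⟩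
    deg (S ─ v) i + 𝟙 (adj G i v)
      ∎
    where open ≡-Reasoning

  deg-─-self : (S : VSet n) {v : Fin n} → S v ≡ true → deg S v ≡ deg (S ─ v) v
  deg-─-self S {v} Sv =
    trans (deg-─ S Sv v) (trans (cong (λ b → deg (S ─ v) v + 𝟙 b) (irrefl G v)) (+-identityʳ _))

  degreeSum-─ : (S : VSet n) {v : Fin n} → S v ≡ true →
    degreeSum S ≡ degreeSum (S ─ v) + 2 * deg S v
  degreeSum-─ S {v} Sv = begin
    ∑[ i < n ] (𝟙 (S i) * deg S i)
      ≡⟨ sum-cong-≗ (λ i → cong₂ _*_ (𝟙S i) (deg-─ S Sv i)) ⟩
    ∑[ i < n ] ((𝟙 (S′ i) + 𝟙 (i == v)) * (deg S′ i + 𝟙 (adj G i v)))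
      ≡⟨ sum-cong-≗ (λ i → expand (𝟙 (S′ i)) (𝟙 (i == v)) (deg S′ i) (𝟙 (adj G i v))) ⟩
    ∑[ i < n ] (𝟙 (S′ i) * deg S′ i + 𝟙 (S′ i) * 𝟙 (adj G i v)
                + (𝟙 (i == v) * deg S′ i + 𝟙 (i == v) * 𝟙 (adj G i v)))
      ≡⟨ ∑-distrib-+ (λ i → 𝟙 (S′ i) * deg S′ i + 𝟙 (S′ i) * 𝟙 (adj G i v)) _ ⟩
    ∑[ i < n ] (𝟙 (S′ i) * deg S′ i + 𝟙 (S′ i) * 𝟙 (adj G i v))
      + ∑[ i < n ] (𝟙 (i == v) * deg S′ i + 𝟙 (i == v) * 𝟙 (adj G i v))
      ≡⟨ cong₂ _+_ (∑-distrib-+ (λ i → 𝟙 (S′ i) * deg S′ i) _)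
                   (∑-distrib-+ (λ i → 𝟙 (i == v) * deg S′ i) _) ⟩
    degreeSum S′ + ∑[ i < n ] (𝟙 (S′ i) * 𝟙 (adj G i v))
      + (∑[ i < n ] (𝟙 (i == v) * deg S′ i) + ∑[ i < n ] (𝟙 (i == v) * 𝟙 (adj G i v)))
      ≡⟨ cong₂ (λ a b → degreeSum S′ + a + b) inner
               (cong₂ _+_ (sum-point v (deg S′)) (sum-point v (λ i → 𝟙 (adj G i v)))) ⟩
    degreeSum S′ + deg S′ v + (deg S′ v + 𝟙 (adj G v v))
      ≡⟨ cong (λ b → degreeSum S′ + deg S′ v + (deg S′ v + 𝟙 b)) (irrefl G v) ⟩
    degreeSum S′ + deg S′ v + (deg S′ v + 0)
      ≡⟨ cong (λ d → degreeSum S′ + d + (d + 0)) (sym (deg-─-self S Sv)) ⟩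
    degreeSum S′ + deg S v + (deg S v + 0)
      ≡⟨ +-assoc (degreeSum S′) _ _ ⟩
    degreeSum S′ + 2 * deg S v
      ∎
    where
    open ≡-Reasoning
    S′ : VSet n
    S′ = S ─ v
    𝟙S : ∀ i → 𝟙 (S i) ≡ 𝟙 (S′ i) + 𝟙 (i == v)
    𝟙S i with i ≟ v
    ... | yes refl rewrite Sv = refl
    ... | no _ = trans (sym (+-identityʳ _)) (cong (λ b → 𝟙 b + 0) (sym (∧-identityʳ (S i))))
    expand : ∀ a b c d → (a + b) * (c + d) ≡ a * c + a * d + (b * c + b * d)
    expand = solve-∀
    inner : ∑[ i < n ] (𝟙 (S′ i) * 𝟙 (adj G i v)) ≡ deg S′ v
    inner = sum-cong-≗ (λ i → trans (sym (𝟙-∧ (S′ i) _)) (cong (λ b → 𝟙 (S′ i ∧ b)) (adj-sym i v)))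

  degreeSum-even : ∀ N (S : VSet n) → count S ≡ N → ∃ λ e → degreeSum S ≡ e + e
  degreeSum-even zero S |S|≡0 = 0 , sum-zero {n} term≡0
    where
    term≡0 : ∀ i → 𝟙 (S i) * deg S i ≡ 0
    term≡0 i with S i in Si
    ... | false = refl
    ... | true with () ← subst (1 ≤_) |S|≡0 (∈⇒count≥1 {p = S} Si)
  degreeSum-even (suc N) S |S|≡1+N with count≥1⇒∈ S (≤-trans (s≤s z≤n) (≤-reflexive (sym |S|≡1+N)))
  ... | v , Sv with degreeSum-even N (S ─ v) (suc-injective (trans (sym (count-─ {p = S} Sv)) |S|≡1+N))
  ... | e , eq =
    e + deg S v , trans (degreeSum-─ S Sv) (trans (cong (_+ 2 * deg S v) eq) (regroup e (deg S v)))
    where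
    regroup : ∀ a b → a + a + 2 * b ≡ a + b + (a + b)
    regroup = solve-∀

  count*≤degreeSum : (S : VSet n) (c : ℕ) → (∀ i → S i ≡ true → c ≤ deg S i) →
    count S * c ≤ degreeSum S
  count*≤degreeSum S c c≤deg = begin
    count S * c                 ≡⟨ *-comm (count S) c ⟩
    c * count S                 ≡⟨ *-distribˡ-sum c (𝟙 ∘ S) ⟩
    ∑[ i < n ] (c * 𝟙 (S i))    ≤⟨ sum-mono-≤ term ⟩
    degreeSum S                 ∎
    where
    open ≤-Reasoning
    term : ∀ i → c * 𝟙 (S i) ≤ 𝟙 (S i) * deg S i
    term i with S i in Si
    ... | true = subst₂ _≤_ (sym (*-identityʳ c)) (sym (+-identityʳ _)) (c≤deg i Si)
    ... | false = ≤-reflexive (*-zeroʳ c)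

  degreeSum≤count* : (S : VSet n) (c : ℕ) → (∀ i → S i ≡ true → deg S i ≤ c) →
    degreeSum S ≤ count S * c
  degreeSum≤count* S c deg≤c = begin
    degreeSum S                 ≤⟨ sum-mono-≤ term ⟩
    ∑[ i < n ] (c * 𝟙 (S i))    ≡⟨ *-distribˡ-sum c (𝟙 ∘ S) ⟨
    c * count S                 ≡⟨ *-comm c (count S) ⟩
    count S * c                 ∎
    where
    open ≤-Reasoning
    term : ∀ i → 𝟙 (S i) * deg S i ≤ c * 𝟙 (S i)
    term i with S i in Si
    ... | true = subst₂ _≤_ (sym (+-identityʳ _)) (sym (*-identityʳ c)) (deg≤c i Si)
    ... | false = ≤-reflexive (sym (*-zeroʳ c))

  deg-≤ : (S Q : VSet n) (i : Fin n) → (∀ j → S j ≡ true → adj G i j ≡ true → Q j ≡ true) →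
    deg S i ≤ count Q
  deg-≤ S Q i sub = count-mono {p = S ∩ nbhd i} {q = Q} (λ j e → sub j (∧-elimˡ e) (∧-elimʳ {S j} e))

  ∩nbhd⊆─ : (S : VSet n) (i : Fin n) → S ∩ nbhd i ⊆ S ─ i
  ∩nbhd⊆─ S i j e = ∈─ S (∧-elimˡ e) (λ j≡i → adj⇒≢ (∧-elimʳ {S j} e) (sym j≡i))

  deg≤count─ : (S : VSet n) (i : Fin n) → deg S i ≤ count (S ─ i)
  deg≤count─ S i = count-mono {p = S ∩ nbhd i} {q = S ─ i} (∩nbhd⊆─ S i)

  deg+deg≤common+count : (S : VSet n) (x y : Fin n) →
    deg S x + deg S y ≤ count (S ∩ nbhd x ∩ nbhd y) + count S
  deg+deg≤common+count S x y = begin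
    deg S x + deg S y
      ≡⟨ cong (deg S x +_) (count-split (S ∩ nbhd y) (nbhd x)) ⟩
    deg S x + (count (S ∩ nbhd y ∩ nbhd x) + count (S ∩ nbhd y ∩ ∁ (nbhd x)))
      ≤⟨ +-monoʳ-≤ (deg S x) (+-mono-≤ (≤-reflexive (count-cong (λ u → ∧-swapʳ (S u) (adj G y u) _)))
                                        (count-mono {p = S ∩ nbhd y ∩ ∁ (nbhd x)} {q = S ∩ ∁ (nbhd x)}
                                          (λ u e → ∧-intro (∧-elimˡ (∧-elimˡ e)) (∧-elimʳ {S u ∧ _} e)))) ⟩
    deg S x + (count (S ∩ nbhd x ∩ nbhd y) + count (S ∩ ∁ (nbhd x)))
      ≡⟨ x∙yz≈y∙xz (deg S x) (count (S ∩ nbhd x ∩ nbhd y)) _ ⟩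
    count (S ∩ nbhd x ∩ nbhd y) + (deg S x + count (S ∩ ∁ (nbhd x)))
      ≡⟨ cong (count (S ∩ nbhd x ∩ nbhd y) +_) (count-split S (nbhd x)) ⟨
    count (S ∩ nbhd x ∩ nbhd y) + count S
      ∎
    where
    open ≤-Reasoning

  common-neighbour : (S : VSet n) (x y : Fin n) → count S < deg S x + deg S y →
    ∃ λ w → S w ≡ true × adj G x w ≡ true × adj G y w ≡ true
  common-neighbour S x y |S|<deg+deg
    with count≥1⇒∈ (S ∩ nbhd x ∩ nbhd y)
           (+-cancelʳ-≤ (count S) 1 _ (≤-trans |S|<deg+deg (deg+deg≤common+count S x y)))
  ... | w , e = w , ∧-elimˡ (∧-elimˡ e) , ∧-elimʳ {S w} (∧-elimˡ e) , ∧-elimʳ {S w ∧ _} e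

  -- Clique covers of vertex sets

  Clique : VSet n → Set
  Clique K = ∀ i j → K i ≡ true → K j ≡ true → i ≢ j → adj G i j ≡ true

  CliqueCoverOf : VSet n → List (VSet n) → Set
  CliqueCoverOf S C =
    (∀ K → K ∈ C → Clique K)
    × (∀ v → S v ≡ true → ∃ λ K → K ∈ C × K v ≡ true)
    × (∀ i j → S i ≡ true → S j ≡ true → adj G i j ≡ true →
         ∃ λ K → K ∈ C × K i ≡ true × K j ≡ true)

  clique-⁅⁆ : ∀ u → Clique ⁅ u ⁆
  clique-⁅⁆ u i j i≡u j≡u i≢j = ⊥-elim (i≢j (trans (==⇒≡ i≡u) (sym (==⇒≡ j≡u))))

  clique-edge : ∀ {a b} → adj G a b ≡ true → Clique (⁅ a ⁆ ∪ ⁅ b ⁆)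
  clique-edge {a} {b} ab i j i∈ j∈ i≢j with ∨-elim i∈ | ∨-elim j∈
  ... | inj₁ i≡a | inj₂ j≡b
    with refl ← ==⇒≡ {i = i} {a} i≡a | refl ← ==⇒≡ {i = j} {b} j≡b = ab
  ... | inj₂ i≡b | inj₁ j≡a
    with refl ← ==⇒≡ {i = i} {b} i≡b | refl ← ==⇒≡ {i = j} {a} j≡a = trans (adj-sym b a) ab
  ... | inj₁ i≡a | inj₁ j≡a = ⊥-elim (i≢j (trans (==⇒≡ i≡a) (sym (==⇒≡ j≡a))))
  ... | inj₂ i≡b | inj₂ j≡b = ⊥-elim (i≢j (trans (==⇒≡ i≡b) (sym (==⇒≡ j≡b))))

  clique-⊆ : ∀ {K K′} → Clique K → K′ ⊆ K → Clique K′
  clique-⊆ cK K′⊆K i j K′i K′j = cK i j (K′⊆K i K′i) (K′⊆K j K′j)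

  clique-insert : ∀ v K → Clique K → K ⊆ nbhd v → Clique (⁅ v ⁆ ∪ K)
  clique-insert v K cK K⊆N i j i∈ j∈ i≢j with ∨-elim i∈ | ∨-elim j∈
  ... | inj₁ i≡v | inj₁ j≡v = ⊥-elim (i≢j (trans (==⇒≡ i≡v) (sym (==⇒≡ j≡v))))
  ... | inj₁ i≡v | inj₂ Kj with refl ← ==⇒≡ {i = i} {v} i≡v = K⊆N j Kj
  ... | inj₂ Ki | inj₁ j≡v with refl ← ==⇒≡ {i = j} {v} j≡v = trans (adj-sym i v) (K⊆N i Ki)
  ... | inj₂ Ki | inj₂ Kj = cK i j Ki Kj i≢j

  Star : VSet n → Fin n → List (VSet n) → Set
  Star S v T =
    (∀ K → K ∈ T → Clique K × K ⊆ nbhd v)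
    × (∃ λ K → K ∈ T)
    × (∀ u → (S ∩ nbhd v) u ≡ true → ∃ λ K → K ∈ T × K u ≡ true)

  cover-star : (S : VSet n) {v : Fin n} → S v ≡ true → ∀ {C T} →
    CliqueCoverOf (S ─ v) C → Star S v T → CliqueCoverOf S (C ++ map (⁅ v ⁆ ∪_) T)
  cover-star S {v} Sv {C} {T} (cliques , covV , covE) (cliquesT , (K₀ , K₀∈T) , covN) =
    cliques′ , covV′ , covE′
    where
    C′ : List (VSet n)
    C′ = C ++ map (⁅ v ⁆ ∪_) T
    ∈C′ : ∀ {K} → K ∈ T → (⁅ v ⁆ ∪ K) ∈ C′
    ∈C′ K∈T = ∈-++⁺ʳ C (∈-map⁺ (⁅ v ⁆ ∪_) K∈T)
    cliques′ : ∀ K → K ∈ C′ → Clique K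
    cliques′ K K∈ with ∈-++⁻ C K∈
    ... | inj₁ K∈C = cliques K K∈C
    ... | inj₂ K∈vT with ∈-map⁻ (⁅ v ⁆ ∪_) K∈vT
    ... | K′ , K′∈T , refl = let cK′ , K′⊆N = cliquesT K′ K′∈T in clique-insert v K′ cK′ K′⊆N
    covV′ : ∀ u → S u ≡ true → ∃ λ K → K ∈ C′ × K u ≡ true
    covV′ u Su with u ≟ v
    ... | yes refl = ⁅ v ⁆ ∪ K₀ , ∈C′ K₀∈T , ∨-introˡ (K₀ v) (==-refl v)
    ... | no u≢v = let K , K∈C , Ku = covV u (∈─ S Su u≢v) in K , ∈-++⁺ˡ K∈C , Ku
    covE′ : ∀ i j → S i ≡ true → S j ≡ true → adj G i j ≡ true →
      ∃ λ K → K ∈ C′ × K i ≡ true × K j ≡ true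
    covE′ i j Si Sj aij with i ≟ v | j ≟ v
    ... | yes refl | _ = let K , K∈T , Kj = covN j (∧-intro Sj aij) in
      ⁅ v ⁆ ∪ K , ∈C′ K∈T , ∨-introˡ (K v) (==-refl v) , ∨-introʳ (j == v) Kj
    ... | no _ | yes refl = let K , K∈T , Ki = covN i (∧-intro Si (trans (adj-sym v i) aij)) in
      ⁅ v ⁆ ∪ K , ∈C′ K∈T , ∨-introʳ (i == v) Ki , ∨-introˡ (K v) (==-refl v)
    ... | no i≢v | no j≢v = let K , K∈C , Ki , Kj = covE i j (∈─ S Si i≢v) (∈─ S Sj j≢v) aij in
      K , ∈-++⁺ˡ K∈C , Ki , Kj

  starOf : VSet n → Fin n → List (VSet n) → VSet n → List (VSet n)
  starOf S v Ps X = Ps ++ collect (S ∩ nbhd v ∩ ∁ X) ⁅_⁆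

  length-starOf : ∀ S v Ps X → length (starOf S v Ps X) ≡ length Ps + count (S ∩ nbhd v ∩ ∁ X)
  length-starOf S v Ps X =
    trans (length-++ Ps) (cong (length Ps +_) (length-collect (S ∩ nbhd v ∩ ∁ X) ⁅_⁆))

  starOf-star : ∀ S v Ps X → (∀ P → P ∈ Ps → Clique P × P ⊆ nbhd v) →
    (∀ u → X u ≡ true → ∃ λ P → P ∈ Ps × P u ≡ true) →
    (∃ λ K → K ∈ starOf S v Ps X) → Star S v (starOf S v Ps X)
  starOf-star S v Ps X cliquesPs covX nonempty = cliques , nonempty , covN
    where
    cliques : ∀ K → K ∈ starOf S v Ps X → Clique K × K ⊆ nbhd v
    cliques K K∈ with ∈-++⁻ Ps K∈
    ... | inj₁ K∈Ps = cliquesPs K K∈Ps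
    ... | inj₂ K∈ with ∈-collect⁻ _ ⁅_⁆ K∈
    ... | u , u∈ , refl =
      clique-⁅⁆ u , λ _ → ∈⁅⁆-elim (λ w → adj G v w ≡ true) (∧-elimʳ {S u} (∧-elimˡ u∈))
    covN : ∀ u → (S ∩ nbhd v) u ≡ true → ∃ λ K → K ∈ starOf S v Ps X × K u ≡ true
    covN u u∈ with X u in Xu
    ... | true = let P , P∈ , Pu = covX u Xu in P , ∈-++⁺ˡ P∈ , Pu
    ... | false =
      ⁅ u ⁆ , ∈-++⁺ʳ Ps (∈-collect⁺ (S ∩ nbhd v ∩ ∁ X) ⁅_⁆ (∧-intro u∈ (not-intro Xu))) , ==-refl u

  -- For an isolated v the star [ ∅ ] still contributes the clique { v }.
  star-trivial : (S : VSet n) (v : Fin n) → ∃ λ T → Star S v T × length T ≤ 1 ⊔ deg S v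
  star-trivial S v with deg S v in d
  ... | zero =
    starOf S v [ ∅ ] ∅ ,
    starOf-star S v [ ∅ ] ∅ (λ { _ (here refl) → (λ _ _ ()) , (λ _ ()) }) (λ _ ()) (∅ , here refl) ,
    ≤-reflexive (trans (length-starOf S v [ ∅ ] ∅) (cong suc (trans (count-∩∁∅ (S ∩ nbhd v)) d)))
  ... | suc _ with count≥1⇒∈ (S ∩ nbhd v) (subst (1 ≤_) (sym d) (s≤s z≤n))
  ... | u , u∈ =
    starOf S v [] ∅ ,
    starOf-star S v [] ∅ (λ _ ()) (λ _ ())
      (⁅ u ⁆ , ∈-collect⁺ (S ∩ nbhd v ∩ ∁ ∅) ⁅_⁆ (∧-intro u∈ refl)) ,
    ≤-reflexive (trans (length-starOf S v [] ∅) (trans (count-∩∁∅ (S ∩ nbhd v)) d))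

  starOf-cost : ∀ S v Ps X {k} → k ≤ count (S ∩ nbhd v ∩ X) →
    k + length (starOf S v Ps X) ≤ length Ps + deg S v
  starOf-cost S v Ps X {k} k≤ = begin
    k + length (starOf S v Ps X)                     ≡⟨ cong (k +_) (length-starOf S v Ps X) ⟩
    k + (length Ps + count (Nᵥ ∩ ∁ X))               ≤⟨ +-monoˡ-≤ _ k≤ ⟩
    count (Nᵥ ∩ X) + (length Ps + count (Nᵥ ∩ ∁ X))  ≡⟨ x∙yz≈y∙xz (count (Nᵥ ∩ X)) (length Ps) _ ⟩
    length Ps + (count (Nᵥ ∩ X) + count (Nᵥ ∩ ∁ X))  ≡⟨ cong (length Ps +_) (count-split Nᵥ X) ⟨
    length Ps + deg S v                              ∎
    where
    open ≤-Reasoning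
    Nᵥ : VSet n
    Nᵥ = S ∩ nbhd v

  edge⊆nbhd : ∀ {S v a b} → (S ∩ nbhd v) a ≡ true → (S ∩ nbhd v) b ≡ true →
    ⁅ a ⁆ ∪ ⁅ b ⁆ ⊆ nbhd v
  edge⊆nbhd {S} {v} {a} {b} a∈ b∈ _ =
    ∈⁅⁆∪⁅⁆-elim (λ z → adj G v z ≡ true) (∧-elimʳ {S a} a∈) (∧-elimʳ {S b} b∈)

  star-triangle : (S : VSet n) (v : Fin n) {a b : Fin n} →
    (S ∩ nbhd v) a ≡ true → (S ∩ nbhd v) b ≡ true → adj G a b ≡ true →
    ∃ λ T → Star S v T × suc (length T) ≤ deg S v
  star-triangle S v {a} {b} a∈ b∈ ab =
    starOf S v [ e ] e ,
    starOf-star S v [ e ] e (λ { _ (here refl) → clique-edge ab , edge⊆nbhd {S} a∈ b∈ })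
      (λ u u∈ → e , here refl , u∈) (e , here refl) ,
    ≤-pred (starOf-cost S v [ e ] e two)
    where
    e : VSet n
    e = ⁅ a ⁆ ∪ ⁅ b ⁆
    p : VSet n
    p = S ∩ nbhd v ∩ e
    two : 2 ≤ count p
    two = count≥suc {p = p} (∧-intro a∈ (∈⁅⁆∪ a ⁅ b ⁆))
      (∈⇒count≥1 {p = p ─ a} (∈─ p (∧-intro b∈ (∈∪⁅⁆ ⁅ a ⁆ b)) (adj⇒≢ ab ∘ sym)))

  star-two-edges : (S : VSet n) (v : Fin n) {a b c d : Fin n} →
    (S ∩ nbhd v) a ≡ true → (S ∩ nbhd v) b ≡ true → (S ∩ nbhd v) c ≡ true → (S ∩ nbhd v) d ≡ true →
    adj G a b ≡ true → adj G c d ≡ true → a ≢ c → a ≢ d → b ≢ c → b ≢ d →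
    ∃ λ T → Star S v T × 2 + length T ≤ deg S v
  star-two-edges S v {a} {b} {c} {d} a∈ b∈ c∈ d∈ ab cd a≢c a≢d b≢c b≢d =
    starOf S v Ps X ,
    starOf-star S v Ps X cliques covX (e₁ , here refl) ,
    ≤-pred (≤-pred (starOf-cost S v Ps X four))
    where
    e₁ e₂ : VSet n
    e₁ = ⁅ a ⁆ ∪ ⁅ b ⁆
    e₂ = ⁅ c ⁆ ∪ ⁅ d ⁆
    Ps : List (VSet n)
    Ps = e₁ ∷ e₂ ∷ []
    X : VSet n
    X = e₁ ∪ e₂
    cliques : ∀ P → P ∈ Ps → Clique P × P ⊆ nbhd v
    cliques _ (here refl) = clique-edge ab , edge⊆nbhd {S} a∈ b∈
    cliques _ (there (here refl)) = clique-edge cd , edge⊆nbhd {S} c∈ d∈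
    covX : ∀ u → X u ≡ true → ∃ λ P → P ∈ Ps × P u ≡ true
    covX u u∈ with ∨-elim {e₁ u} u∈
    ... | inj₁ u∈e₁ = e₁ , here refl , u∈e₁
    ... | inj₂ u∈e₂ = e₂ , there (here refl) , u∈e₂
    p : VSet n
    p = S ∩ nbhd v ∩ X
    a∈p : p a ≡ true
    a∈p = ∧-intro a∈ (∨-introˡ (e₂ a) (∈⁅⁆∪ a ⁅ b ⁆))
    b∈p : p b ≡ true
    b∈p = ∧-intro b∈ (∨-introˡ (e₂ b) (∈∪⁅⁆ ⁅ a ⁆ b))
    c∈p : p c ≡ true
    c∈p = ∧-intro c∈ (∨-introʳ (e₁ c) (∈⁅⁆∪ c ⁅ d ⁆))
    d∈p : p d ≡ true
    d∈p = ∧-intro d∈ (∨-introʳ (e₁ d) (∈∪⁅⁆ ⁅ c ⁆ d))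
    four : 4 ≤ count p
    four =
      count≥suc {p = p} a∈p
        (count≥suc {p = p ─ a} (∈─ p b∈p (adj⇒≢ ab ∘ sym))
          (count≥suc {p = p ─ a ─ b} (∈─ (p ─ a) (∈─ p c∈p (a≢c ∘ sym)) (b≢c ∘ sym))
            (∈⇒count≥1 {p = p ─ a ─ b ─ c}
              (∈─ (p ─ a ─ b) (∈─ (p ─ a) (∈─ p d∈p (a≢d ∘ sym)) (b≢d ∘ sym)) (adj⇒≢ cd ∘ sym)))))

  cover-fan : (S : VSet n) {x y w : Fin n} → S x ≡ true → S y ≡ true → S w ≡ true →
    adj G x y ≡ true → adj G x w ≡ true → adj G y w ≡ true → ∀ {C} → CliqueCoverOf (S ─ x ─ y) C →
    ∃ λ C′ → CliqueCoverOf S C′ × length C′ ≤ length C + count (S ─ x ─ y)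
  cover-fan S {x} {y} {w} Sx Sy Sw xy xw yw {C} (cliques , covV , covE) =
    C′ , (cliques′ , covV′ , covE′) ,
    ≤-trans (≤-reflexive (trans (length-++ C) (cong (length C +_) (length-collect P fan))))
            (+-monoʳ-≤ (length C) (count-mono {p = P} {q = S″} (λ _ → ∧-elimˡ)))
    where
    e : VSet n
    e = ⁅ x ⁆ ∪ ⁅ y ⁆
    S″ : VSet n
    S″ = S ─ x ─ y
    P : VSet n
    P = S″ ∩ (nbhd x ∪ nbhd y)
    fan : Fin n → VSet n
    fan z = ⁅ z ⁆ ∪ (nbhd z ∩ e)
    C′ : List (VSet n)
    C′ = C ++ collect P fan

    ∉e⇒∈S″ : ∀ {t} → S t ≡ true → e t ≡ false → S″ t ≡ true
    ∉e⇒∈S″ St et = let t≠x , t≠y = ∨-false et in ∧-intro (∧-intro St (not-intro t≠x)) (not-intro t≠y)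
    fan∈C′ : ∀ {z} → S″ z ≡ true → ∀ {t} → e t ≡ true → adj G t z ≡ true → fan z ∈ C′
    fan∈C′ {z} S″z et tz = ∈-++⁺ʳ C (∈-collect⁺ P fan (∧-intro S″z
      (∈⁅⁆∪⁅⁆-elim (λ t → adj G t z ≡ true → (nbhd x ∪ nbhd y) z ≡ true)
        (∨-introˡ (adj G y z)) (∨-introʳ (adj G x z)) et tz)))
    fan∋self : ∀ z → fan z z ≡ true
    fan∋self z = ∨-introˡ _ (==-refl z)
    fan∋ : ∀ {z t} → e t ≡ true → adj G t z ≡ true → fan z t ≡ true
    fan∋ {z} {t} et tz = ∨-introʳ (t == z) (∧-intro (trans (adj-sym z t) tz) et)
    e-adj-w : ∀ {t} → e t ≡ true → adj G t w ≡ true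
    e-adj-w = ∈⁅⁆∪⁅⁆-elim (λ t → adj G t w ≡ true) xw yw
    S″w : S″ w ≡ true
    S″w = ∈─ (S ─ x) (∈─ S Sw (adj⇒≢ xw ∘ sym)) (adj⇒≢ yw ∘ sym)
    fanW∈C′ : fan w ∈ C′
    fanW∈C′ = fan∈C′ S″w (∨-introˡ _ (==-refl x)) xw

    cliques′ : ∀ K → K ∈ C′ → Clique K
    cliques′ K K∈ with ∈-++⁻ C K∈
    ... | inj₁ K∈C = cliques K K∈C
    ... | inj₂ K∈fans with ∈-collect⁻ P fan K∈fans
    ... | z , _ , refl =
      clique-insert z (nbhd z ∩ e) (clique-⊆ (clique-edge xy) (λ _ → ∧-elimʳ)) (λ _ → ∧-elimˡ)
    covV′ : ∀ u → S u ≡ true → ∃ λ K → K ∈ C′ × K u ≡ true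
    covV′ u Su with e u in eu
    ... | true = fan w , fanW∈C′ , fan∋ eu (e-adj-w eu)
    ... | false = let K , K∈C , Ku = covV u (∉e⇒∈S″ Su eu) in K , ∈-++⁺ˡ K∈C , Ku
    covE′ : ∀ i j → S i ≡ true → S j ≡ true → adj G i j ≡ true →
      ∃ λ K → K ∈ C′ × K i ≡ true × K j ≡ true
    covE′ i j Si Sj ij with e i in ei | e j in ej
    ... | true | true = fan w , fanW∈C′ , fan∋ ei (e-adj-w ei) , fan∋ ej (e-adj-w ej)
    ... | true | false = fan j , fan∈C′ (∉e⇒∈S″ Sj ej) ei ij , fan∋ ei ij , fan∋self j
    ... | false | true = fan i , fan∈C′ (∉e⇒∈S″ Si ei) ej ji , fan∋self i , fan∋ ej ji
      where ji = trans (adj-sym j i) ij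
    ... | false | false = let K , K∈C , Ki , Kj = covE i j (∉e⇒∈S″ Si ei) (∉e⇒∈S″ Sj ej) ij in
      K , ∈-++⁺ˡ K∈C , Ki , Kj

  -- Dense vertex sets have small clique covers

  HasEdge : VSet n → Set
  HasEdge X = ∃₂ λ a b → X a ≡ true × X b ≡ true × adj G a b ≡ true

  hasEdge? : ∀ X → Dec (HasEdge X)
  hasEdge? X =
    map′ (λ (a , b , e) → let Xb∧ab = ∧-elimʳ {X a} e in
                          a , b , ∧-elimˡ e , ∧-elimˡ Xb∧ab , ∧-elimʳ {X b} Xb∧ab)
         (λ (a , b , Xa , Xb , ab) → a , b , ∧-intro Xa (∧-intro Xb ab))
         (any? λ a → any? λ b → (X a ∧ X b ∧ adj G a b) ≟ᵇ true)

  Coverable : VSet n → ℕ → Set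
  Coverable S b = ∃ λ C → CliqueCoverOf S C × length C ≤ b

  DenseCoverable : ℕ → Set
  DenseCoverable N = ∀ S → count S ≡ N → 2 * ⌊ N ²/4⌋ + 2 ≤ degreeSum S → Coverable S ⌊ N ∸ 1 ²/4⌋

  count─≡ : (S : VSet n) {u : Fin n} {N : ℕ} → S u ≡ true → count S ≡ suc N → count (S ─ u) ≡ N
  count─≡ S Su |S|≡ = suc-injective (trans (sym (count-─ {p = S} Su)) |S|≡)

  module DenseStep (m : ℕ) (ih₂ : DenseCoverable (2 + m)) (ih₁ : DenseCoverable (1 + m))
    (S : VSet n) (|S|≡ : count S ≡ 3 + m) (dense : 2 * ⌊ 3 + m ²/4⌋ + 2 ≤ degreeSum S)
    (v : Fin n) (Sv : S v ≡ true) (minimal : ∀ u → S u ≡ true → deg S v ≤ deg S u) where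

    δ : ℕ
    δ = deg S v

    Goal : Set
    Goal = Coverable S ⌊ 2 + m ²/4⌋

    Nᵥ : VSet n
    Nᵥ = S ∩ nbhd v

    degreeSum≥ : (3 + m) * δ ≤ degreeSum S
    degreeSum≥ = subst (λ N → N * δ ≤ degreeSum S) |S|≡ (count*≤degreeSum S δ minimal)

    δ≤2+m : δ ≤ 2 + m
    δ≤2+m = ≤-trans (deg≤count─ S v) (≤-reflexive (count─≡ S Sv |S|≡))

    dense-without : ∀ {u} → deg S u ≤ ⌊ 3 + m /2⌋ → 2 * ⌊ 2 + m ²/4⌋ + 2 + 2 * deg S u ≤ degreeSum S
    dense-without {u} d≤ = ≤-trans (≤-reflexive (regroup ⌊ 2 + m ²/4⌋ (deg S u)))
      (≤-trans (+-monoˡ-≤ 2 (*-monoʳ-≤ 2 (⌊n²/4⌋+≤ (2 + m) d≤))) dense)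
      where
      regroup : ∀ a b → 2 * a + 2 + 2 * b ≡ 2 * (a + b) + 2
      regroup = solve-∀

    via-star : ∀ {u T} → S u ≡ true → 2 * ⌊ 2 + m ²/4⌋ + 2 + 2 * deg S u ≤ degreeSum S →
      Star S u T → length T ≤ ⌊ 2 + m /2⌋ → Goal
    via-star {u} {T} Su dense′ star |T|≤
      with ih₂ (S ─ u) (count─≡ S Su |S|≡)
             (+-cancelʳ-≤ (2 * deg S u) _ _ (≤-trans dense′ (≤-reflexive (degreeSum-─ S Su))))
    ... | C , cover , |C|≤ = C ++ map (⁅ u ⁆ ∪_) T , cover-star S Su cover star , (begin
      length (C ++ map (⁅ u ⁆ ∪_) T)  ≡⟨ trans (length-++ C) (cong (length C +_) (length-map _ T)) ⟩
      length C + length T             ≤⟨ +-monoˡ-≤ (length T) |C|≤ ⟩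
      ⌊ 1 + m ²/4⌋ + length T         ≤⟨ ⌊n²/4⌋+≤ (1 + m) |T|≤ ⟩
      ⌊ 2 + m ²/4⌋                    ∎)
      where open ≤-Reasoning

    count─v─≡ : ∀ {y} → Nᵥ y ≡ true → count (S ─ v ─ y) ≡ 1 + m
    count─v─≡ {y} y∈ = count─≡ (S ─ v) (∩nbhd⊆─ S v y y∈) (count─≡ S Sv |S|≡)

    via-fan : ∀ {y w} → Nᵥ y ≡ true → Nᵥ w ≡ true → adj G y w ≡ true →
      2 * ⌊ 1 + m ²/4⌋ + 2 ≤ degreeSum (S ─ v ─ y) → Goal
    via-fan {y} {w} y∈ w∈ yw dense″
      with ih₁ (S ─ v ─ y) (count─v─≡ y∈) dense″
         | cover-fan S Sv (∧-elimˡ y∈) (∧-elimˡ w∈) (∧-elimʳ {S y} y∈) (∧-elimʳ {S w} w∈) yw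
    ... | C , cover , |C|≤ | extend with extend cover
    ... | C′ , cover′ , |C′|≤ =
      C′ , cover′ , ≤-trans |C′|≤ (+-mono-≤ |C|≤ (≤-reflexive (count─v─≡ y∈)))

    small-degree : δ ≤ ⌊ 2 + m /2⌋ → Goal
    small-degree δ≤ =
      let T , star , |T|≤ = star-trivial S v in
      via-star Sv (dense-without (≤-trans δ≤ (⌊n/2⌋-mono (n≤1+n (2 + m)))))
        star (≤-trans |T|≤ (⊔-lub (s≤s z≤n) δ≤))

    complete : δ ≡ 2 + m → Goal
    complete δ≡ =
      [ S ] ,
      ( (λ { _ (here refl) → clique })
      , (λ u Su → S , here refl , Su)
      , (λ i j Si Sj _ → S , here refl , Si , Sj)) ,
      ≤-trans (s≤s z≤n) (m≤n+m (suc m) ⌊ m ²/4⌋)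
      where
      clique : Clique S
      clique i j Si Sj i≢j =
        ∧-elimʳ {S j} (⊆-count⇒⊇ {p = S ∩ nbhd i} {q = S ─ i} (∩nbhd⊆─ S i)
          (≤-trans (≤-reflexive (trans (count─≡ S Si |S|≡) (sym δ≡))) (minimal i Si))
          j (∈─ S Sj (i≢j ∘ sym)))

    triangle-at-v : ⌊ 3 + m /2⌋ < δ → HasEdge Nᵥ
    triangle-at-v h<δ with count≥1⇒∈ Nᵥ (≤-trans (s≤s z≤n) h<δ)
    ... | a , a∈ with common-neighbour S v a (subst (_< δ + deg S a) (sym |S|≡)
                        (≤-trans (⌊n/2⌋<m⇒n<m+m (3 + m) δ h<δ) (+-monoʳ-≤ δ (minimal a (∧-elimˡ a∈)))))
    ... | b , Sb , vb , ab = a , b , a∈ , ∧-intro Sb vb , ab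

    cost-half : ∀ {l d} → suc l ≤ d → d ≤ ⌊ 3 + m /2⌋ → l ≤ ⌊ 2 + m /2⌋
    cost-half sl≤d d≤ = ≤-pred (≤-trans sl≤d (≤-trans d≤ (⌊1+n/2⌋≤1+⌊n/2⌋ (2 + m))))

    -- Every neighbour of v has its neighbours in W = S - N(v), and |W| = δ is the minimum degree,
    -- so each neighbour of v is adjacent to all of W.
    module HalfIndependent (δ≡ : δ ≡ ⌊ 3 + m /2⌋) (N≡ : 3 + m ≡ δ + δ) (indep : ¬ HasEdge Nᵥ) where

      W : VSet n
      W = S ∩ ∁ (nbhd v)

      nbhd⊆W : ∀ {i} → Nᵥ i ≡ true → ∀ z → S z ≡ true → adj G i z ≡ true → W z ≡ true
      nbhd⊆W {i} i∈ z Sz iz with adj G v z in vz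
      ... | true = ⊥-elim (indep (i , z , i∈ , ∧-intro Sz vz , iz))
      ... | false = ∧-intro Sz refl

      |W|≡δ : count W ≡ δ
      |W|≡δ = +-cancelˡ-≡ δ _ _ (trans (sym (count-split S (nbhd v))) (trans |S|≡ N≡))

      deg≤δ : ∀ {i} → Nᵥ i ≡ true → deg S i ≤ δ
      deg≤δ i∈ = ≤-trans (deg-≤ S W _ (nbhd⊆W i∈)) (≤-reflexive |W|≡δ)

      W⊆nbhd : ∀ {u} → Nᵥ u ≡ true → W ⊆ S ∩ nbhd u
      W⊆nbhd {u} u∈ = ⊆-count⇒⊇ {p = S ∩ nbhd u} {q = W}
        (λ z e → nbhd⊆W u∈ z (∧-elimˡ e) (∧-elimʳ {S z} e))
        (≤-trans (≤-reflexive |W|≡δ) (minimal u (∧-elimˡ u∈)))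

      all-deg≤δ : ¬ HasEdge W → ∀ i → S i ≡ true → deg S i ≤ δ
      all-deg≤δ indepW i Si with adj G v i in vi
      ... | true = deg≤δ (∧-intro Si vi)
      ... | false = deg-≤ S Nᵥ i into-Nᵥ
        where
        into-Nᵥ : ∀ z → S z ≡ true → adj G i z ≡ true → Nᵥ z ≡ true
        into-Nᵥ z Sz iz with adj G v z in vz
        ... | true = ∧-intro Sz refl
        ... | false = ⊥-elim (indepW (i , z , ∧-intro Si (not-intro vi) , ∧-intro Sz (not-intro vz) , iz))

      at : (∃ λ u → Nᵥ u ≡ true) → Goal
      at (u , u∈) with hasEdge? W
      ... | yes (a , b , a∈ , b∈ , ab) =
        let T , star , |T|< = star-triangle S u (W⊆nbhd u∈ a a∈) (W⊆nbhd u∈ b b∈) ab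
            d≤ = ≤-trans (deg≤δ u∈) (≤-reflexive δ≡) in
        via-star (∧-elimˡ u∈) (dense-without d≤) star (cost-half |T|< d≤)
      ... | no indepW = ⊥-elim (half-too-sparse δ (degreeSum S)
        (subst (λ N → 2 * ⌊ N ²/4⌋ + 2 ≤ degreeSum S) N≡ dense)
        (≤-trans (degreeSum≤count* S δ (all-deg≤δ indepW)) (≤-reflexive (cong (_* δ) (trans |S|≡ N≡)))))

      goal : Goal
      goal = at (count≥1⇒∈ Nᵥ (≤-trans (s≤s z≤n) (≤-reflexive (sym δ≡))))

    half-degree : δ ≡ ⌊ 3 + m /2⌋ → ¬ δ ≤ ⌊ 2 + m /2⌋ → Goal
    half-degree δ≡ δ≰ with parity (3 + m) | hasEdge? Nᵥ
    ... | odd N≡ | _ =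
      ⊥-elim (δ≰ (≤-reflexive (trans δ≡ (trans (n≡⌊n+n/2⌋ _) (cong ⌊_/2⌋ (sym (suc-injective N≡)))))))
    ... | even N≡ | yes (a , b , a∈ , b∈ , ab) =
      let T , star , |T|< = star-triangle S v a∈ b∈ ab in
      via-star Sv (dense-without (≤-reflexive δ≡)) star (cost-half |T|< (≤-reflexive δ≡))
    ... | even N≡ | no indep =
      HalfIndependent.goal δ≡ (trans N≡ (cong₂ _+_ (sym δ≡) (sym δ≡))) indep

    half-plus-one-odd : ∀ k → 3 + m ≡ suc (k + k) → δ ≡ suc k → δ ≤ 1 + m → HasEdge Nᵥ → Goal
    half-plus-one-odd k N≡ δ≡ δ≤ (a , b , a∈ , b∈ , ab) =
      let T , star , |T|< = star-triangle S v a∈ b∈ ab in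
      via-star Sv dense′ star
        (≤-trans (≤-pred (≤-trans |T|< (≤-reflexive δ≡)))
                 (≤-reflexive (trans (n≡⌊n+n/2⌋ k) (cong ⌊_/2⌋ (sym M≡)))))
      where
      M≡ : 2 + m ≡ k + k
      M≡ = suc-injective N≡
      2≤k : 2 ≤ k
      2≤k = +-cancelʳ-≤ k 2 k (≤-trans (s≤s (≤-trans (≤-reflexive (sym δ≡)) δ≤)) (≤-reflexive M≡))
      dense′ : 2 * ⌊ 2 + m ²/4⌋ + 2 + 2 * δ ≤ degreeSum S
      dense′ = begin
        2 * ⌊ 2 + m ²/4⌋ + 2 + 2 * δ
          ≡⟨ cong₂ (λ M d → 2 * ⌊ M ²/4⌋ + 2 + 2 * d) M≡ δ≡ ⟩
        2 * ⌊ k + k ²/4⌋ + 2 + 2 * suc k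
          ≤⟨ odd-budget k (degreeSum S) 2≤k (degreeSum-even (3 + m) S |S|≡)
               (≤-trans (≤-reflexive (cong₂ _*_ (sym N≡) (sym δ≡))) degreeSum≥) ⟩
        degreeSum S
          ∎
        where open ≤-Reasoning

    module HalfPlusOneEven (j : ℕ) (N≡ : 3 + m ≡ suc j + suc j) (δ≡ : δ ≡ suc (suc j)) (δ≤ : δ ≤ 1 + m)
      {a b : Fin n} (a∈ : Nᵥ a ≡ true) (b∈ : Nᵥ b ≡ true) (ab : adj G a b ≡ true) where

      M≡ : 2 + m ≡ suc (j + j)
      M≡ = trans (suc-injective N≡) (+-suc j j)

      2≤j : 2 ≤ j
      2≤j = ≤-pred (+-cancelʳ-≤ (suc j) 3 (suc j)
        (≤-trans (s≤s (s≤s (≤-trans (≤-reflexive (sym δ≡)) δ≤))) (≤-reflexive N≡)))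

      dense′ : 2 * ⌊ 2 + m ²/4⌋ + 2 + 2 * δ ≤ degreeSum S
      dense′ = begin
        2 * ⌊ 2 + m ²/4⌋ + 2 + 2 * δ
          ≡⟨ cong₂ (λ M d → 2 * ⌊ M ²/4⌋ + 2 + 2 * d) M≡ δ≡ ⟩
        2 * ⌊ suc (j + j) ²/4⌋ + 2 + 2 * suc (suc j)
          ≤⟨ even-budget j (degreeSum S) (≤-trans (s≤s z≤n) 2≤j)
               (≤-trans (≤-reflexive (cong₂ _*_ (sym N≡) (sym δ≡))) degreeSum≥) ⟩
        degreeSum S
          ∎
        where open ≤-Reasoning

      via-two-edges : ∀ {T} → Star S v T → 2 + length T ≤ δ → Goal
      via-two-edges star |T|< = via-star Sv dense′ star
        (≤-trans (≤-pred (≤-pred (≤-trans |T|< (≤-reflexive δ≡))))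
                 (≤-reflexive (trans (sym (⌊1+n+n/2⌋≡n j)) (cong ⌊_/2⌋ (sym M≡)))))

      e : VSet n
      e = ⁅ a ⁆ ∪ ⁅ b ⁆

      X : VSet n
      X = Nᵥ ∩ ∁ e

      X-elim : ∀ {z} → X z ≡ true → Nᵥ z ≡ true × z ≢ a × z ≢ b
      X-elim {z} z∈ = let z≠a , z≠b = ∨-false (not-elim (∧-elimʳ {Nᵥ z} z∈)) in
        ∧-elimˡ z∈ , ==false⇒≢ z≠a , ==false⇒≢ z≠b

      -- z has at least 2δ - |S| = 2 neighbours in Nᵥ, and they can only be a and b.
      adjacent-to-edge : ¬ HasEdge X → ∀ {z} → X z ≡ true → adj G z a ≡ true × adj G z b ≡ true
      adjacent-to-edge indepX {z} z∈ =
        ∧-elimʳ {Nᵥ a} (e⊆common a (∈⁅⁆∪ a ⁅ b ⁆)) , ∧-elimʳ {Nᵥ b} (e⊆common b (∈∪⁅⁆ ⁅ a ⁆ b))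
        where
        common : VSet n
        common = Nᵥ ∩ nbhd z
        common⊆e : common ⊆ e
        common⊆e u u∈ with e u in eu
        ... | true = refl
        ... | false =
          ⊥-elim (indepX (z , u , z∈ , ∧-intro (∧-elimˡ u∈) (not-intro eu) , ∧-elimʳ {Nᵥ u} u∈))
        2≤common : 2 ≤ count common
        2≤common = +-cancelʳ-≤ (suc j + suc j) 2 _ (begin
          2 + (suc j + suc j)            ≡⟨ cong (2 +_) (sym (+-suc j (suc j))) ⟩
          suc (suc j) + suc (suc j)      ≡⟨ cong₂ _+_ δ≡ δ≡ ⟨
          δ + δ                          ≤⟨ +-monoʳ-≤ δ (minimal z (∧-elimˡ (∧-elimˡ z∈))) ⟩
          δ + deg S z                    ≤⟨ deg+deg≤common+count S v z ⟩
          count common + count S         ≡⟨ cong (count common +_) (trans |S|≡ N≡) ⟩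
          count common + (suc j + suc j) ∎)
          where open ≤-Reasoning
        e⊆common : e ⊆ common
        e⊆common = ⊆-count⇒⊇ {p = common} {q = e} common⊆e (≤-trans (count-⁅⁆∪⁅⁆ a b) 2≤common)

      2≤|X| : 2 ≤ count X
      2≤|X| = +-cancelˡ-≤ 2 2 (count X) (begin
        4                               ≤⟨ ≤-trans (s≤s (s≤s (s≤s (s≤s z≤n)))) (s≤s (s≤s 2≤j)) ⟩
        suc (suc j)                     ≡⟨ sym δ≡ ⟩
        δ                               ≡⟨ count-split Nᵥ e ⟩
        count (Nᵥ ∩ e) + count X        ≤⟨ +-monoˡ-≤ (count X) |Nᵥ∩e|≤2 ⟩
        2 + count X                     ∎)
        where
        open ≤-Reasoning
        |Nᵥ∩e|≤2 : count (Nᵥ ∩ e) ≤ 2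
        |Nᵥ∩e|≤2 = ≤-trans (count-mono {p = Nᵥ ∩ e} {q = e} (λ _ → ∧-elimʳ)) (count-⁅⁆∪⁅⁆ a b)

      goal : Goal
      goal with hasEdge? X
      ... | yes (c , d , c∈ , d∈ , cd) =
        let c∈′ , c≢a , c≢b = X-elim c∈ ; d∈′ , d≢a , d≢b = X-elim d∈
            T , star , |T|< = star-two-edges S v a∈ b∈ c∈′ d∈′ ab cd
                                (c≢a ∘ sym) (d≢a ∘ sym) (c≢b ∘ sym) (d≢b ∘ sym) in
        via-two-edges star |T|<
      ... | no indepX with count≥1⇒∈ X (≤-trans (s≤s z≤n) 2≤|X|)
      ... | c , c∈ with count≥1⇒∈ (X ─ c) (≤-pred (≤-trans 2≤|X| (≤-reflexive (count-─ {p = X} c∈))))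
      ... | d , d∈─ =
        let d∈ = ∧-elimˡ d∈─ ; d≢c = ==false⇒≢ (not-elim (∧-elimʳ {X d} d∈─))
            c∈′ , c≢a , c≢b = X-elim c∈ ; d∈′ , d≢a , d≢b = X-elim d∈
            ca , _ = adjacent-to-edge indepX c∈ ; _ , db = adjacent-to-edge indepX d∈
            T , star , |T|< = star-two-edges S v a∈ c∈′ b∈ d∈′
                                (trans (adj-sym a c) ca) (trans (adj-sym b d) db)
                                (adj⇒≢ ab) (d≢a ∘ sym) c≢b (d≢c ∘ sym) in
        via-two-edges star |T|<

    half-plus-one : δ ≡ suc ⌊ 3 + m /2⌋ → δ ≤ 1 + m → Goal
    half-plus-one δ≡ δ≤ with parity (3 + m) | triangle-at-v (≤-reflexive (sym δ≡))
    ... | odd N≡ | triangle = half-plus-one-odd ⌊ 3 + m /2⌋ N≡ δ≡ δ≤ triangle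
    ... | even N≡ | a , b , a∈ , b∈ , ab = HalfPlusOneEven.goal ⌊ 1 + m /2⌋ N≡ δ≡ δ≤ a∈ b∈ ab

    degreeSum-─v─ : ∀ {y} → Nᵥ y ≡ true →
      degreeSum S ≡ degreeSum (S ─ v ─ y) + 2 * deg (S ─ v) y + 2 * δ
    degreeSum-─v─ {y} y∈ =
      trans (degreeSum-─ S Sv) (cong (_+ 2 * δ) (degreeSum-─ (S ─ v) (∩nbhd⊆─ S v y y∈)))

    large-degree : 2 + ⌊ 3 + m /2⌋ ≤ δ → δ ≤ 1 + m → Goal
    large-degree δ≥ δ≤ with triangle-at-v (≤-trans (n≤1+n _) δ≥)
    ... | y , w , y∈ , w∈ , yw = via-fan y∈ w∈ yw
      (fan-budget (1 + m) δ (degreeSum (S ─ v ─ y)) (deg (S ─ v) y)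
        (≤-trans (s≤s (s≤s (s≤s z≤n))) (≤-trans δ≥ δ≤)) δ≥
        (≤-trans degreeSum≥ (≤-reflexive (degreeSum-─v─ y∈)))
        (≤-trans (deg≤count─ (S ─ v) y) (≤-reflexive (count─v─≡ y∈))))

    goal : Goal
    goal with δ ≤? ⌊ 2 + m /2⌋
    ... | yes δ≤ = small-degree δ≤
    ... | no δ≰ with δ ≟ℕ 2 + m
    ...   | yes δ≡ = complete δ≡
    ...   | no δ≢ with δ ≟ℕ ⌊ 3 + m /2⌋ | δ ≟ℕ suc ⌊ 3 + m /2⌋
    ...     | yes δ≡ | _ = half-degree δ≡ δ≰
    ...     | no _ | yes δ≡ = half-plus-one δ≡ (≤-pred (≤∧≢⇒< δ≤2+m δ≢))
    ...     | no δ≢h | no δ≢h+1 = large-degree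
      (≤∧≢⇒< (≤∧≢⇒< (≤-trans (⌊1+n/2⌋≤1+⌊n/2⌋ (2 + m)) (≰⇒> δ≰)) (δ≢h ∘ sym)) (δ≢h+1 ∘ sym))
      (≤-pred (≤∧≢⇒< δ≤2+m δ≢))

  degreeSum≤ : (S : VSet n) → degreeSum S ≤ count S * (count S ∸ 1)
  degreeSum≤ S = degreeSum≤count* S (count S ∸ 1)
    (λ i Si → ≤-trans (deg≤count─ S i) (≤-reflexive (cong (_∸ 1) (sym (count-─ {p = S} Si)))))

  dense≤ : ∀ {N} S → count S ≡ N → 2 * ⌊ N ²/4⌋ + 2 ≤ degreeSum S → 2 * ⌊ N ²/4⌋ + 2 ≤ N * (N ∸ 1)
  dense≤ S refl dense = ≤-trans dense (degreeSum≤ S)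

  dense⇒coverable : ∀ N → DenseCoverable N
  dense⇒coverable 0 S |S|≡ dense with () ← dense≤ S |S|≡ dense
  dense⇒coverable 1 S |S|≡ dense with () ← dense≤ S |S|≡ dense
  dense⇒coverable 2 S |S|≡ dense with s≤s (s≤s ()) ← dense≤ S |S|≡ dense
  dense⇒coverable (suc (suc (suc m))) S |S|≡ dense =
    let v , Sv , minimal = argmin S (deg S) (count≥1⇒∈ S (≤-trans (s≤s z≤n) (≤-reflexive (sym |S|≡)))) in
    DenseStep.goal m (dense⇒coverable (suc (suc m))) (dense⇒coverable (suc m)) S |S|≡ dense v Sv minimal

  𝟙-adj-split : ∀ i j →
    𝟙 (adj G i j) ≡ 𝟙 ((toℕ i <ᵇ toℕ j) ∧ adj G i j) + 𝟙 ((toℕ j <ᵇ toℕ i) ∧ adj G j i)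
  𝟙-adj-split i j
    with toℕ i <ᵇ toℕ j | <ᵇ-reflects-< (toℕ i) (toℕ j) | toℕ j <ᵇ toℕ i | <ᵇ-reflects-< (toℕ j) (toℕ i)
  ... | true | ofʸ i<j | true | ofʸ j<i = ⊥-elim (<-asym i<j j<i)
  ... | true | _ | false | _ = sym (+-identityʳ _)
  ... | false | _ | true | _ = cong 𝟙 (adj-sym i j)
  ... | false | ofⁿ i≮j | false | ofⁿ j≮i
    with refl ← toℕ-injective (≤-antisym (≮⇒≥ j≮i) (≮⇒≥ i≮j)) = cong 𝟙 (irrefl G i)

  handshake : degreeSum full ≡ 2 * numEdges G
  handshake = begin
    degreeSum full
      ≡⟨ sum-cong-≗ (λ i → +-identityʳ (deg full i)) ⟩
    ∑[ i < n ] ∑[ j < n ] 𝟙 (adj G i j)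
      ≡⟨ sum-cong-≗ (λ i → trans (sum-cong-≗ (𝟙-adj-split i))
                                 (∑-distrib-+ (λ j → 𝟙 (up i j)) (λ j → 𝟙 (up j i)))) ⟩
    ∑[ i < n ] (∑[ j < n ] 𝟙 (up i j) + ∑[ j < n ] 𝟙 (up j i))
      ≡⟨ ∑-distrib-+ (λ i → ∑[ j < n ] 𝟙 (up i j)) (λ i → ∑[ j < n ] 𝟙 (up j i)) ⟩
    E + ∑[ i < n ] ∑[ j < n ] 𝟙 (up j i)
      ≡⟨ cong (E +_) (∑-comm (λ i j → 𝟙 (up j i))) ⟩
    E + E
      ≡⟨ cong (λ e → e + e) E≡ ⟩
    numEdges G + numEdges G
      ≡⟨ cong (numEdges G +_) (sym (+-identityʳ (numEdges G))) ⟩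
    2 * numEdges G
      ∎
    where
    open ≡-Reasoning
    up : Fin n → Fin n → Bool
    up i j = (toℕ i <ᵇ toℕ j) ∧ adj G i j
    E : ℕ
    E = ∑[ i < n ] ∑[ j < n ] 𝟙 (up i j)
    if≡𝟙 : ∀ b → (if b then 1 else 0) ≡ 𝟙 b
    if≡𝟙 true = refl
    if≡𝟙 false = refl
    E≡ : E ≡ numEdges G
    E≡ = sym (begin
      numEdges G                                      ≡⟨ sum-allFin (λ i → List.sum (map (term i) (allFin n))) ⟩
      ∑[ i < n ] List.sum (map (term i) (allFin n))    ≡⟨ sum-cong-≗ (λ i → sum-allFin (term i)) ⟩
      ∑[ i < n ] ∑[ j < n ] term i j                   ≡⟨ sum-cong-≗ (λ i → sum-cong-≗ (λ j → if≡𝟙 (up i j))) ⟩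
      E                                               ∎)
      where
      term : Fin n → Fin n → ℕ
      term i j = if up i j then 1 else 0

  toSubset : VSet n → Subset n
  toSubset = Vec.tabulate

  ∈toSubset⁺ : ∀ {K i} → K i ≡ true → i ∈ₛ toSubset K
  ∈toSubset⁺ {K} {i} Ki = Vec.lookup⇒[]= i (toSubset K) (trans (Vec.lookup∘tabulate K i) Ki)

  ∈toSubset⁻ : ∀ {K i} → i ∈ₛ toSubset K → K i ≡ true
  ∈toSubset⁻ {K} {i} i∈ = trans (sym (Vec.lookup∘tabulate K i)) (Vec.[]=⇒lookup i∈)

  isCliqueCover : ∀ {C} → CliqueCoverOf full C → IsCliqueCover G (map toSubset C)
  isCliqueCover {C} (cliques , covV , covE) = All.tabulate cliques′ , covV′ , covE′
    where
    cliques′ : ∀ {K′} → K′ ∈ map toSubset C → IsClique G K′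
    cliques′ K′∈ with ∈-map⁻ toSubset K′∈
    ... | K , K∈ , refl = λ i j i∈ j∈ → cliques K K∈ i j (∈toSubset⁻ i∈) (∈toSubset⁻ j∈)
    covV′ : ∀ v → ∃ λ K′ → K′ ∈ map toSubset C × v ∈ₛ K′
    covV′ v = let K , K∈ , Kv = covV v refl in toSubset K , ∈-map⁺ toSubset K∈ , ∈toSubset⁺ Kv
    covE′ : ∀ i j → adj G i j ≡ true → ∃ λ K′ → K′ ∈ map toSubset C × i ∈ₛ K′ × j ∈ₛ K′
    covE′ i j ij = let K , K∈ , Ki , Kj = covE i j refl refl ij in
      toSubset K , ∈-map⁺ toSubset K∈ , ∈toSubset⁺ Ki , ∈toSubset⁺ Kj

upper-bound : ∀ {n} (G : Graph n) → numEdges G ≡ n * n / 4 + 1 →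
  ∃ λ C → IsCliqueCover G C × length C ≤ (n ∸ 1) * (n ∸ 1) / 4
upper-bound {n} G |E|≡ =
  let C , cover , |C|≤ = dense⇒coverable G n full count-full dense in
  map (toSubset G) C , isCliqueCover G cover ,
  ≤-trans (≤-reflexive (length-map (toSubset G) C))
          (≤-trans |C|≤ (≤-reflexive (sym (n*n/4≡⌊n²/4⌋ (n ∸ 1)))))
  where
  dense : 2 * ⌊ n ²/4⌋ + 2 ≤ degreeSum G full
  dense = ≤-reflexive (sym (begin
    degreeSum G full      ≡⟨ handshake G ⟩
    2 * numEdges G        ≡⟨ cong (2 *_) (trans |E|≡ (cong (_+ 1) (n*n/4≡⌊n²/4⌋ n))) ⟩
    2 * (⌊ n ²/4⌋ + 1)    ≡⟨ *-distribˡ-+ 2 ⌊ n ²/4⌋ 1 ⟩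
    2 * ⌊ n ²/4⌋ + 2      ∎))
    where open ≡-Reasoning

-- The extremal graph

isLeft : ∀ {A B : Set} → A ⊎ B → Bool
isLeft (inj₁ _) = true
isLeft (inj₂ _) = false

count-isLeft∘splitAt : ∀ p {q} → count {p + q} (isLeft ∘ splitAt p) ≡ p
count-isLeft∘splitAt zero {q} = sum-zero {q} (λ _ → refl)
count-isLeft∘splitAt (suc p) {q} =
  cong suc (trans (count-cong {p = isLeft ∘ map₁ suc ∘ splitAt p} (isLeft∘map₁ ∘ splitAt p))
                  (count-isLeft∘splitAt p))
  where
  isLeft∘map₁ : ∀ {A B C : Set} {f : A → C} (z : A ⊎ B) → isLeft (map₁ f z) ≡ isLeft z
  isLeft∘map₁ (inj₁ _) = refl
  isLeft∘map₁ (inj₂ _) = refl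

module Extremal (p s : ℕ) where

  r : ℕ
  r = 2 + s

  L : VSet (p + r)
  L = isLeft ∘ splitAt p

  L-↑ˡ : ∀ a → L (a ↑ˡ r) ≡ true
  L-↑ˡ a = cong isLeft (splitAt-↑ˡ p a r)

  L-↑ʳ : ∀ b → L (p ↑ʳ b) ≡ false
  L-↑ʳ b = cong isLeft (splitAt-↑ʳ p r b)

  x y : Fin (p + r)
  x = p ↑ʳ zero
  y = p ↑ʳ suc zero

  ≢x : ∀ {i} → L i ≡ true → i == x ≡ false
  ≢x {i} Li = ≢⇒==false {i = i} {x} λ { refl → case trans (sym Li) (L-↑ʳ zero) of λ () }

  ≢y : ∀ {i} → L i ≡ true → i == y ≡ false
  ≢y {i} Li = ≢⇒==false {i = i} {y} λ { refl → case trans (sym Li) (L-↑ʳ (suc zero)) of λ () }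

  y==x : y == x ≡ false
  y==x = ≢⇒==false {i = y} {x} λ e → case ↑ʳ-injective p (suc zero) zero e of λ ()

  extra : Fin (p + r) → VSet (p + r)
  extra i j = (i == x ∧ j == y) ∨ (j == x ∧ i == y)

  extra-irrefl : ∀ i → extra i i ≡ false
  extra-irrefl i with i ≟ x | i ≟ y
  ... | yes refl | yes y≡x = case trans (sym (dec-true (y ≟ x) (sym y≡x))) y==x of λ ()
  ... | yes refl | no _ = refl
  ... | no _ | yes refl = refl
  ... | no _ | no _ = refl

  G₀ : Graph (p + r)
  G₀ = record
    { adj = λ i j → (L i xor L j) ∨ extra i j
    ; sym = λ i j → cong₂ _∨_ (xor-comm (L i) (L j)) (∨-comm (i == x ∧ j == y) (j == x ∧ i == y))
    ; irrefl = λ i → cong₂ _∨_ (xor-same (L i)) (extra-irrefl i)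
    }

  L⇒¬extra : ∀ {i} → L i ≡ true → ∀ j → extra i j ≡ false
  L⇒¬extra Li j rewrite ≢x Li | ≢y Li = ∧-zeroʳ (j == x)

  extra⇒¬L : ∀ i j → extra i j ≡ true → L j ≡ false
  extra⇒¬L i j e with ∨-elim {i == x ∧ j == y} e
  ... | inj₁ e₁ rewrite ==⇒≡ {i = j} {y} (∧-elimʳ {i == x} e₁) = L-↑ʳ (suc zero)
  ... | inj₂ e₂ rewrite ==⇒≡ {i = j} {x} (∧-elimˡ e₂) = L-↑ʳ zero

  nbhd-L : ∀ {i} → L i ≡ true → ∀ j → (full ∩ nbhd G₀ i) j ≡ ∁ L j
  nbhd-L {i} Li j rewrite Li | L⇒¬extra Li j = ∨-identityʳ (not (L j))

  nbhd-∁L : ∀ {i} → L i ≡ false → ∀ j → (full ∩ nbhd G₀ i) j ≡ (L ∪ extra i) j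
  nbhd-∁L Li j rewrite Li = refl

  count-L : count L ≡ p
  count-L = count-isLeft∘splitAt p

  count-∁L : count (∁ L) ≡ r
  count-∁L = +-cancelˡ-≡ p _ _ (begin
    p + count (∁ L)            ≡⟨ cong (_+ count (∁ L)) count-L ⟨
    count L + count (∁ L)      ≡⟨ count-split full L ⟨
    count {p + r} full         ≡⟨ count-full ⟩
    p + r                      ∎)
    where open ≡-Reasoning

  count-extra : ∀ i → count (extra i) ≡ 𝟙 (i == x) + 𝟙 (i == y)
  count-extra i = begin
    count (extra i)
      ≡⟨ count-∪-disjoint (λ j → i == x ∧ j == y) (λ j → j == x ∧ i == y) disjoint ⟩
    count (λ j → i == x ∧ ⁅ y ⁆ j) + count (λ j → ⁅ x ⁆ j ∧ i == y)
      ≡⟨ cong (count (λ j → i == x ∧ ⁅ y ⁆ j) +_) (count-cong (λ j → ∧-comm (j == x) (i == y))) ⟩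
    count (λ j → i == x ∧ ⁅ y ⁆ j) + count (λ j → i == y ∧ ⁅ x ⁆ j)
      ≡⟨ cong₂ _+_ (count-const∩ (i == x) ⁅ y ⁆) (count-const∩ (i == y) ⁅ x ⁆) ⟩
    𝟙 (i == x) * count ⁅ y ⁆ + 𝟙 (i == y) * count ⁅ x ⁆
      ≡⟨ cong₂ (λ a b → 𝟙 (i == x) * a + 𝟙 (i == y) * b) (count-⁅⁆ y) (count-⁅⁆ x) ⟩
    𝟙 (i == x) * 1 + 𝟙 (i == y) * 1
      ≡⟨ cong₂ _+_ (*-identityʳ (𝟙 (i == x))) (*-identityʳ (𝟙 (i == y))) ⟩
    𝟙 (i == x) + 𝟙 (i == y)
      ∎
    where
    open ≡-Reasoning
    disjoint : ∀ j → (i == x ∧ j == y) ≡ true → (j == x ∧ i == y) ≡ false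
    disjoint j e rewrite ==⇒≡ {i = j} {y} (∧-elimʳ {i == x} e) | y==x = refl

  deg₀ : ∀ i → deg G₀ full i ≡ 𝟙 (L i) * r + 𝟙 (not (L i)) * p + (𝟙 (i == x) + 𝟙 (i == y))
  deg₀ i = by-side (L i) refl
    where
    open ≡-Reasoning
    by-side : ∀ b → L i ≡ b → deg G₀ full i ≡ 𝟙 b * r + 𝟙 (not b) * p + (𝟙 (i == x) + 𝟙 (i == y))
    by-side true Li = begin
      count (full ∩ nbhd G₀ i)                  ≡⟨ count-cong (nbhd-L Li) ⟩
      count (∁ L)                               ≡⟨ count-∁L ⟩
      r                                         ≡⟨ solve r p ⟩
      1 * r + 0 * p + (𝟙 false + 𝟙 false)       ≡⟨ cong₂ (λ a b → 1 * r + 0 * p + (𝟙 a + 𝟙 b)) (≢x Li) (≢y Li) ⟨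
      1 * r + 0 * p + (𝟙 (i == x) + 𝟙 (i == y)) ∎
      where
      solve : ∀ r p → r ≡ 1 * r + 0 * p + 0
      solve = solve-∀
    by-side false Li = begin
      count (full ∩ nbhd G₀ i)                  ≡⟨ count-cong (nbhd-∁L Li) ⟩
      count (L ∪ extra i)                       ≡⟨ count-∪-disjoint L (extra i) (λ j → contraposeᵇ (extra⇒¬L i j)) ⟩
      count L + count (extra i)                 ≡⟨ cong₂ _+_ count-L (count-extra i) ⟩
      p + (𝟙 (i == x) + 𝟙 (i == y))             ≡⟨ cong (_+ (𝟙 (i == x) + 𝟙 (i == y))) (solve r p) ⟩
      0 * r + 1 * p + (𝟙 (i == x) + 𝟙 (i == y)) ∎
      where
      solve : ∀ r p → p ≡ 0 * r + 1 * p
      solve = solve-∀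

  degreeSum₀ : degreeSum G₀ full ≡ p * r + r * p + 2
  degreeSum₀ = begin
    ∑[ i < p + r ] (1 * deg G₀ full i)
      ≡⟨ sum-cong-≗ (λ i → trans (+-identityʳ _) (deg₀ i)) ⟩
    ∑[ i < p + r ] (𝟙 (L i) * r + 𝟙 (not (L i)) * p + (𝟙 (i == x) + 𝟙 (i == y)))
      ≡⟨ ∑-distrib-+ (λ i → 𝟙 (L i) * r + 𝟙 (not (L i)) * p) (λ i → 𝟙 (i == x) + 𝟙 (i == y)) ⟩
    ∑[ i < p + r ] (𝟙 (L i) * r + 𝟙 (not (L i)) * p) + ∑[ i < p + r ] (𝟙 (i == x) + 𝟙 (i == y))
      ≡⟨ cong₂ _+_ (∑-distrib-+ (λ i → 𝟙 (L i) * r) (λ i → 𝟙 (not (L i)) * p))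
                   (∑-distrib-+ (λ i → 𝟙 (i == x)) (λ i → 𝟙 (i == y))) ⟩
    ∑[ i < p + r ] (𝟙 (L i) * r) + ∑[ i < p + r ] (𝟙 (not (L i)) * p) + (count ⁅ x ⁆ + count ⁅ y ⁆)
      ≡⟨ cong₂ (λ a b → a + b + (count ⁅ x ⁆ + count ⁅ y ⁆))
               (*-distribʳ-sum r (𝟙 ∘ L)) (*-distribʳ-sum p (𝟙 ∘ ∁ L)) ⟨
    count L * r + count (∁ L) * p + (count ⁅ x ⁆ + count ⁅ y ⁆)
      ≡⟨ cong₂ _+_ (cong₂ (λ a b → a * r + b * p) count-L count-∁L)
                   (cong₂ _+_ (count-⁅⁆ x) (count-⁅⁆ y)) ⟩
    p * r + r * p + 2
      ∎
    where open ≡-Reasoning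

  numEdges₀ : numEdges G₀ ≡ p * r + 1
  numEdges₀ = *-cancelˡ-≡ (numEdges G₀) (p * r + 1) 2
    (trans (sym (handshake G₀)) (trans degreeSum₀ (double p r)))
    where
    double : ∀ p r → p * r + r * p + 2 ≡ 2 * (p * r + 1)
    double = solve-∀

  ∈clique-independent : ∀ {K} → IsClique G₀ K → ∀ {u u′} → u ∈ₛ K → u′ ∈ₛ K →
    adj G₀ u u′ ≡ false → u ≡ u′
  ∈clique-independent cK {u} {u′} u∈ u′∈ uu′ with u ≟ u′
  ... | yes u≡u′ = u≡u′
  ... | no u≢u′ = case trans (sym uu′) (cK u u′ u∈ u′∈ u≢u′) of λ ()

  left : Fin p → Fin (p + r)
  left a = a ↑ˡ r

  right : Fin (suc s) → Fin (p + r)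
  right b = p ↑ʳ suc b

  right≢x : ∀ b → right b == x ≡ false
  right≢x b = ≢⇒==false {i = right b} {x} λ e → case ↑ʳ-injective p (suc b) zero e of λ ()

  crossing : ∀ a b → adj G₀ (left a) (right b) ≡ true
  crossing a b rewrite L-↑ˡ a | L-↑ʳ (suc b) = refl

  left-independent : ∀ a a′ → adj G₀ (left a) (left a′) ≡ false
  left-independent a a′ rewrite L-↑ˡ a | L-↑ˡ a′ = L⇒¬extra (L-↑ˡ a) (left a′)

  right-independent : ∀ b b′ → adj G₀ (right b) (right b′) ≡ false
  right-independent b b′ rewrite L-↑ʳ (suc b) | L-↑ʳ (suc b′) | right≢x b | right≢x b′ = refl

  clique-edge-unique : ∀ {K} → IsClique G₀ K → ∀ {a a′ b b′} →
    left a ∈ₛ K → right b ∈ₛ K → left a′ ∈ₛ K → right b′ ∈ₛ K → (a , b) ≡ (a′ , b′)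
  clique-edge-unique cK {a} {a′} {b} {b′} la rb la′ rb′ = cong₂ _,_
    (↑ˡ-injective r a a′ (∈clique-independent cK la la′ (left-independent a a′)))
    (Fin-suc-injective (↑ʳ-injective p (suc b) (suc b′) (∈clique-independent cK rb rb′ (right-independent b b′))))

  lower-bound : ∀ C → IsCliqueCover G₀ C → p * suc s ≤ length C
  lower-bound C (cliques , _ , covE) = injective⇒≤ {f = cliqueIndex} cliqueIndex-injective
    where
    edge : Fin (p * suc s) → Fin p × Fin (suc s)
    edge = remQuot (suc s)
    edgeClique : ∀ c → ∃ λ K → K ∈ C × left (proj₁ (edge c)) ∈ₛ K × right (proj₂ (edge c)) ∈ₛ K
    edgeClique c = let a , b = edge c in covE (left a) (right b) (crossing a b)
    cliqueIndex : Fin (p * suc s) → Fin (length C)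
    cliqueIndex c = index (proj₁ (proj₂ (edgeClique c)))
    cliqueIndex-injective : ∀ {c c′} → cliqueIndex c ≡ cliqueIndex c′ → c ≡ c′
    cliqueIndex-injective {c} {c′} eq
      with edgeClique c | edgeClique c′
         | lookup-index (proj₁ (proj₂ (edgeClique c))) | lookup-index (proj₁ (proj₂ (edgeClique c′)))
    ... | K , K∈ , la , rb | K′ , K′∈ , la′ , rb′ | K≡ | K′≡ = begin
      c                         ≡⟨ combine-remQuot {p} (suc s) c ⟨
      uncurry combine (edge c)  ≡⟨ cong (uncurry combine) (clique-edge-unique (All.lookup cliques K∈) la rb
                                     (subst (left (proj₁ (edge c′)) ∈ₛ_) (sym K≡K′) la′)
                                     (subst (right (proj₂ (edge c′)) ∈ₛ_) (sym K≡K′) rb′)) ⟩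
      uncurry combine (edge c′) ≡⟨ combine-remQuot {p} (suc s) c′ ⟩
      c′                        ∎
      where
      open ≡-Reasoning
      K≡K′ : K ≡ K′
      K≡K′ = trans K≡ (trans (cong (lookup C) eq) (sym K′≡))

balanced-split : ∀ n → 4 ≤ n →
  ∃₂ λ p s → n ≡ p + (2 + s) × p * (2 + s) ≡ ⌊ n ²/4⌋ × p * suc s ≡ ⌊ n ∸ 1 ²/4⌋
balanced-split n 4≤n with parity n
... | even n≡ with ⌊ n /2⌋ | n≡
...   | 0 | refl with () ← 4≤n
...   | 1 | refl with s≤s (s≤s ()) ← 4≤n
...   | suc (suc j) | refl = suc (suc j) , j , refl , sym (⌊k+k²/4⌋ (suc (suc j))) , sym (begin
  ⌊ suc (j + suc (suc j)) ²/4⌋   ≡⟨ cong (λ t → ⌊ suc t ²/4⌋) (+-suc j (suc j)) ⟩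
  ⌊ suc (suc j + suc j) ²/4⌋     ≡⟨ ⌊1+k+k²/4⌋ (suc j) ⟩
  suc j * suc j + suc j          ≡⟨ regroup j ⟩
  suc (suc j) * suc j            ∎)
  where
  open ≡-Reasoning
  regroup : ∀ j → suc j * suc j + suc j ≡ suc (suc j) * suc j
  regroup = solve-∀
balanced-split n 4≤n | odd n≡ with ⌊ n /2⌋ | n≡
...   | 0 | refl with s≤s () ← 4≤n
...   | 1 | refl with s≤s (s≤s (s≤s ())) ← 4≤n
...   | suc (suc j) | refl = suc (suc j) , suc j , sym (+-suc (suc (suc j)) (suc (suc j))) ,
  trans (regroup j) (sym (⌊1+k+k²/4⌋ (suc (suc j)))) , sym (⌊k+k²/4⌋ (suc (suc j)))
  where
  regroup : ∀ j → suc (suc j) * suc (suc (suc j)) ≡ suc (suc j) * suc (suc j) + suc (suc j)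
  regroup = solve-∀

lemma16 : ∀ (n : ℕ) → 4 ≤ n →
    IsMaxCliqueCoverNumber n (n * n / 4 + 1) ((n ∸ 1) * (n ∸ 1) / 4)
lemma16 n 4≤n with balanced-split n 4≤n
... | p , s , refl , |E|≡⌊n²/4⌋ , θ≡⌊[n-1]²/4⌋ =
  (G₀ , |E|≡ , (C₀ , cover₀ , ≤-antisym |C₀|≤ (minimal C₀ cover₀)) , minimal) , maximal
  where
  open Extremal p s
  |E|≡ : numEdges G₀ ≡ (p + r) * (p + r) / 4 + 1
  |E|≡ = trans numEdges₀ (cong (_+ 1) (trans |E|≡⌊n²/4⌋ (sym (n*n/4≡⌊n²/4⌋ (p + r)))))
  θ≡ : (p + r ∸ 1) * (p + r ∸ 1) / 4 ≡ p * suc s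
  θ≡ = trans (n*n/4≡⌊n²/4⌋ (p + r ∸ 1)) (sym θ≡⌊[n-1]²/4⌋)
  minimal : ∀ C → IsCliqueCover G₀ C → (p + r ∸ 1) * (p + r ∸ 1) / 4 ≤ length C
  minimal C cover = ≤-trans (≤-reflexive θ≡) (lower-bound C cover)
  C₀ : List (Subset (p + r))
  C₀ = proj₁ (upper-bound G₀ |E|≡)
  cover₀ : IsCliqueCover G₀ C₀
  cover₀ = proj₁ (proj₂ (upper-bound G₀ |E|≡))
  |C₀|≤ : length C₀ ≤ (p + r ∸ 1) * (p + r ∸ 1) / 4
  |C₀|≤ = proj₂ (proj₂ (upper-bound G₀ |E|≡))
  maximal : ∀ G → numEdges G ≡ (p + r) * (p + r) / 4 + 1 → ∀ k → IsCliqueCoverNumber G k →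
    k ≤ (p + r ∸ 1) * (p + r ∸ 1) / 4
  maximal G |E|≡′ k (_ , k≤) = let C , cover , |C|≤ = upper-bound G |E|≡′ in ≤-trans (k≤ C cover) |C|≤
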